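{- The map $\phi:\mathcal L_{n-1}C_n\to\mathcal A_n$ defined below is a bijection satisfying $\operatorname{cDes}(\phi\pi)=\operatorname{cDes}(\pi)$ and $(\phi\pi)^{ -1}(n)=\pi^{ -1}(n)$ for all $\pi\in\mathcal L_{n-1}C_n$. In particular, \[\sum_{\pi\in\mathcal A_n}\mathbf x^{\operatorname{cDes}(\pi)}t^{\pi^{ -1}(n)}=\sum_{\pi\in\mathcal L_{n-1}C_n}\mathbf x^{\operatorname{cDes}(\pi)}t^{\pi^{ -1}(n)}.\] Definition of $\phi$: given $\pi\in\mathcal L_{n-1}C_n$, let $j=\pi^{ -1}(n)$. Set $(\phi\pi)(j)=n$. If $n\in\operatorname{cDes}(\pi)$, the set of the first $j-1$ entries of $\phi\pi$ is $[j-1]$; otherwise it is $[n-1]\setminus[n-j]$. The first $j-1$ entries of $\phi\pi$ are arranged as the unique left-unimodal sequence on that set with descent set $\operatorname{Des}(\pi)\cap[j-2]$, and the last $n-j$ entries (the remaining values) are arranged as the unique right-unimodal sequence on those values with descent set $\{i-j: i\in\operatorname{Des}(\pi),\ i>j\}$.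
   Context: A sequence $a_1,\dots,a_m$ of distinct integers is left-unimodal if it is the union of an increasing and a decreasing subsequence meeting at $a_1$ (equivalently, each prefix is a set of consecutive integers); it is right-unimodal if $a_m,\dots,a_1$ is left-unimodal. For a given $m$-element set and a given subset of $[m-1]$, there is a unique left-unimodal (resp. right-unimodal) arrangement of the set with that descent set, where the descent set of a sequence is $\{i:a_i>a_{i+1}\}$. $\mathcal L_{n-1}\subseteq\mathfrak S_{n-1}$ is the set of left-unimodal permutations, viewed in $\mathfrak S_n$ by fixing $n$. A permutation $\pi\in\mathfrak S_n$ is an arc permutation if for every $j$ the set $\{\pi(1),\dots,\pi(j)\}$ is an interval in $\mathbb Z_n$; $\mathcal A_n$ is the set of arc permutations. Permutations are multiplied as functions, $(\sigma\tau)(i)=\sigma(\tau(i))$; $c_n=(1,2,\dots,n)=23\cdots n1$, $C_n=\langle c_n\rangle$, $XY=\{xy:x\in X,y\in Y\}$. For $\pi\in\mathfrak S_n$, $\operatorname{Des}(\pi)=\{i\in[n-1]:\pi(i)>\pi(i+1)\}$, $\operatorname{cDes}(\pi)=\{i\in[n]:\pi(i)>\pi(i+1)\}$ with $\pi(n+1):=\pi(1)$; $\mathbf x^S=\prod_{i\in S}x_i$, $t$ an extra variable. -}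

module Defs where

open import Data.Nat using (ℕ; zero; suc; _+_; _∸_; _≤_; _<_; _<?_; _≤?_; _≡ᵇ_; NonZero)
open import Data.Nat.Properties using (_≟_)
open import Data.Nat.DivMod using (_%_)
open import Data.Bool using (Bool; true; false; if_then_else_)
open import Data.List using (List; []; _∷_; map; filter; upTo; take; drop; reverse; length)
open import Data.List.Membership.Propositional using (_∈_)
open import Data.List.Membership.DecPropositional _≟_ using (_∈?_)
open import Data.List.Relation.Binary.Permutation.Propositional using (_↭_)
open import Data.Product using (_×_; ∃; ∃-syntax)
open import Relation.Nullary using (¬_; does)
open import Relation.Binary.PropositionalEquality using (_≡_)
open import Function.Bundles using (_⇔_)

-- Conventions.
-- A sequence / permutation is given in one-line notation as a List ℕ;
-- positions are 1-based, values of a permutation of [n] are 1..n.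

range1 : ℕ → List ℕ
range1 k = map suc (upTo k)

-- 0-based lookup with default 0 (only ever used in range)
at : List ℕ → ℕ → ℕ
at []       _       = 0
at (x ∷ xs) zero    = x
at (x ∷ xs) (suc i) = at xs i

nth : List ℕ → ℕ → ℕ
nth xs i = at xs (i ∸ 1)

-- 1-based position of the (first) occurrence of x in w; for a permutation
-- w of [n] and 1 ≤ x ≤ n this is w⁻¹(x)
posOf : ℕ → List ℕ → ℕ
posOf x []       = 1
posOf x (y ∷ ys) = if x ≡ᵇ y then 1 else suc (posOf x ys)

IsPerm : ℕ → List ℕ → Set
IsPerm n w = w ↭ range1 n

idw : ℕ → List ℕ
idw n = range1 n

-- product (σ τ)(i) = σ(τ(i)); one-line notation of στ is σ applied to τ
_·_ : List ℕ → List ℕ → List ℕ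
σ · τ = map (nth σ) τ

-- cₙ = (1,2,…,n) = 2 3 ⋯ n 1
cyc : (n : ℕ) → .{{NonZero n}} → List ℕ
cyc n = map (λ i → suc (suc i % n)) (upTo n)

pow : ℕ → List ℕ → ℕ → List ℕ
pow n w zero    = idw n
pow n w (suc k) = w · pow n w k

Des : List ℕ → List ℕ
Des xs = filter (λ i → nth xs (suc i) <? nth xs i) (range1 (length xs ∸ 1))

csucc : ℕ → ℕ → ℕ
csucc n i = if i ≡ᵇ n then 1 else suc i

cDes : ℕ → List ℕ → List ℕ
cDes n w = filter (λ i → nth w (csucc n i) <? nth w i) (range1 n)

-- left-unimodal: the union of an increasing and a decreasing subsequence
-- meeting at a₁, i.e. the entries above a₁ appear increasingly and the
-- entries below a₁ appear decreasingly
LeftUnimodal : List ℕ → Set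
LeftUnimodal xs =
  ∀ p q → 1 < p → p < q → q ≤ length xs →
    (nth xs 1 < nth xs p → nth xs 1 < nth xs q → nth xs p < nth xs q) ×
    (nth xs p < nth xs 1 → nth xs q < nth xs 1 → nth xs q < nth xs p)

RightUnimodal : List ℕ → Set
RightUnimodal xs = LeftUnimodal (reverse xs)

-- 𝓛_{n-1} viewed inside 𝔖ₙ by fixing n
InL : ℕ → List ℕ → Set
InL n σ = IsPerm n σ × nth σ n ≡ n × LeftUnimodal (take (n ∸ 1) σ)

InLC : (n : ℕ) → .{{NonZero n}} → List ℕ → Set
InLC n π = ∃[ σ ] ∃[ k ] (InL n σ × π ≡ σ · pow n (cyc n) k)

-- the cyclic interval {a+1, a+2, …, a+k} of ℤₙ, with residues written as 1..n
cycInt : (n : ℕ) → .{{NonZero n}} → ℕ → ℕ → List ℕ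
cycInt n a k = map (λ i → suc ((a + i) % n)) (upTo k)

InA : (n : ℕ) → .{{NonZero n}} → List ℕ → Set
InA n π = IsPerm n π ×
  (∀ j → ∃[ a ] ∃[ k ] (∀ x → (x ∈ take j π) ⇔ (x ∈ cycInt n a k)))

FirstSet : ℕ → List ℕ → ℕ → Set
FirstSet n π x =
  if does (n ∈? cDes n π)
  then (1 ≤ x × x ≤ posOf n π ∸ 1)
  else ((1 ≤ x × x ≤ n ∸ 1) × ¬ (1 ≤ x × x ≤ n ∸ posOf n π))

-- Φ n π w  :⇔  w = φ(π)  (graph of the map φ of the statement)
Phi : ℕ → List ℕ → List ℕ → Set
Phi n π w =
  let j = posOf n π in
  IsPerm n w ×
  nth w j ≡ n ×
  (∀ x → (x ∈ take (j ∸ 1) w) ⇔ FirstSet n π x) ×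
  LeftUnimodal (take (j ∸ 1) w) ×
  Des (take (j ∸ 1) w) ≡ filter (λ i → i ≤? j ∸ 2) (Des π) ×
  RightUnimodal (drop j w) ×
  Des (drop j w) ≡ map (λ i → i ∸ j) (filter (λ i → j <? i) (Des π))

Enumerates : (List ℕ → Set) → List (List ℕ) → Set
Enumerates P xs = Unique xs × (∀ π → (π ∈ xs) ⇔ P π)
  where open import Data.List.Relation.Unary.Unique.Propositional using (Unique)

-- the monomial x^{cDes(π)} t^{π⁻¹(n)}, recorded by its exponent data
-- (distinct exponent data ⇔ distinct monomials)
monomial : ℕ → List ℕ → List ℕ × ℕ
monomial n π = cDes n π , posOf n π
  where open import Data.Product using (_,_)

module Submission where

-- A permutation in 𝓛_{n-1}Cₙ has the form v n u′ where u′v is a left-unimodal arrangement of [n-1],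
-- and an arc permutation has the form A n B with A left-unimodal, B right-unimodal and the value
-- sets of A and B complementary intervals of [n-1], A being the lower one exactly when n is a cyclic
-- descent. A unimodal arrangement of an interval is determined by its descent set, and the descents
-- of u′v are those of v n u′ together with the cyclic descent at n. So both families are
-- parametrised by the same data (lengths and descents of the two blocks, and whether n is a cyclic
-- descent), which φ preserves; hence φ is a bijection preserving cDes and the position of n, and
-- the generating functions agree because φ maps an enumeration of 𝓛_{n-1}Cₙ onto one of 𝓐ₙ.

open import Data.Bool using (Bool; true; false; if_then_else_; not)
open import Data.Bool.Properties using (not-involutive; T-≡)
open import Data.Empty using (⊥; ⊥-elim; ⊥-elim-irr)
open import Data.List hiding (lookup)
open import Data.List.Properties
open import Data.List.Membership.Propositional using (_∈_; _∉_)
open import Data.List.Membership.Propositional.Properties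
open import Data.List.Membership.Propositional.Properties.WithK using (unique∧set⇒bag)
open import Data.List.Relation.Binary.BagAndSetEquality using (∼bag⇒↭)
open import Data.List.Relation.Binary.Permutation.Propositional using (_↭_; ↭-sym; ↭-reflexive; ↭⇒↭ₛ)
open import Data.List.Relation.Binary.Permutation.Propositional.Properties using (∈-resp-↭; ↭-length; ↭-reverse; All-resp-↭)
open import Data.List.Relation.Unary.All as All using (All; []; _∷_)
import Data.List.Relation.Unary.Any.Properties as AnyP
open import Data.List.Relation.Unary.Any using (here; there)
open import Data.List.Relation.Unary.Unique.Propositional using (Unique; []; _∷_)
import Data.List.Relation.Unary.Unique.Propositional.Properties as UP
open import Data.Nat
open import Data.Nat.DivMod
open import Data.Nat.Properties
open import Data.List.Membership.DecPropositional _≟_ using (_∈?_)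
open import Data.Product using (Σ; _×_; _,_; proj₁; proj₂; ∃-syntax)
open import Data.Sum using (_⊎_; inj₁; inj₂)
import Data.Sum as Sum
open import Data.Unit using (⊤; tt)
open import Function.Bundles using (_⇔_; mk⇔; module Equivalence)
open Equivalence using (to; from)
open import Relation.Binary.Definitions using (tri<; tri≈; tri>)
open import Relation.Binary.PropositionalEquality hiding ([_])
open import Relation.Nullary
open import Relation.Nullary.Decidable using (dec-true; dec-false)
open import Relation.Unary using (Pred; Decidable)
open import Data.List.Relation.Binary.Permutation.Setoid.Properties (setoid ℕ) using (Unique-resp-↭)

open import Defs

++-injective : ∀ {a} {A : Set a} (xs ys us vs : List A) → length xs ≡ length us →
  xs ++ ys ≡ us ++ vs → xs ≡ us × ys ≡ vs
++-injective [] ys [] vs l e = refl , e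
++-injective (x ∷ xs) ys (u ∷ us) vs l e with ∷-injective e
... | refl , e' with ++-injective xs ys us vs (suc-injective l) e'
... | refl , refl = refl , refl

take-length-++ : ∀ (A B : List ℕ) → take (length A) (A ++ B) ≡ A
take-length-++ [] B = refl
take-length-++ (a ∷ A) B = cong (a ∷_) (take-length-++ A B)

drop-length-++ : ∀ (A B : List ℕ) → drop (length A) (A ++ B) ≡ B
drop-length-++ [] B = refl
drop-length-++ (a ∷ A) B = drop-length-++ A B

take-++≤ : ∀ (u v : List ℕ) r → r ≤ length u → take r (u ++ v) ≡ take r u
take-++≤ u v zero _ = refl
take-++≤ (x ∷ u) v (suc r) (s≤s le) = cong (x ∷_) (take-++≤ u v r le)

drop-++≤ : ∀ (u v : List ℕ) r → r ≤ length u → drop r (u ++ v) ≡ drop r u ++ v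
drop-++≤ u v zero _ = refl
drop-++≤ (x ∷ u) v (suc r) (s≤s le) = drop-++≤ u v r le

take-split : ∀ (P Q : List ℕ) y a → length P ≡ a → take a (P ++ y ∷ Q) ≡ P
take-split P Q y a l = subst (λ k → take k (P ++ y ∷ Q) ≡ P) l (take-length-++ P (y ∷ Q))

drop-split : ∀ (P Q : List ℕ) y a → length P ≡ a → drop (suc a) (P ++ y ∷ Q) ≡ Q
drop-split P Q y a l = subst (λ k → drop (suc k) (P ++ y ∷ Q) ≡ Q) l (h P)
  where
  h : ∀ P → drop (suc (length P)) (P ++ y ∷ Q) ≡ Q
  h [] = refl
  h (x ∷ P) = h P

take-after : ∀ (A B : List ℕ) y t → take (suc (length A) + t) (A ++ y ∷ B) ≡ A ++ y ∷ take t B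
take-after [] B y t = refl
take-after (x ∷ A) B y t = cong (x ∷_) (take-after A B y t)

drop-after : ∀ (A B : List ℕ) y t → drop (suc (length A) + t) (A ++ y ∷ B) ≡ drop t B
drop-after [] B y t = refl
drop-after (x ∷ A) B y t = drop-after A B y t

∈-take : ∀ {x} k (xs : List ℕ) → x ∈ take k xs → x ∈ xs
∈-take (suc k) (y ∷ xs) (here e) = here e
∈-take (suc k) (y ∷ xs) (there p) = there (∈-take k xs p)

at-++ˡ : ∀ A B i → i < length A → at (A ++ B) i ≡ at A i
at-++ˡ (a ∷ A) B zero _ = refl
at-++ˡ (a ∷ A) B (suc i) (s≤s lt) = at-++ˡ A B i lt

at-++ʳ : ∀ A B i → at (A ++ B) (length A + i) ≡ at B i
at-++ʳ [] B i = refl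
at-++ʳ (a ∷ A) B i = at-++ʳ A B i

at-∈ : ∀ xs i → i < length xs → at xs i ∈ xs
at-∈ (x ∷ xs) zero _ = here refl
at-∈ (x ∷ xs) (suc i) (s≤s lt) = there (at-∈ xs i lt)

∈-at : ∀ xs {x} → x ∈ xs → Σ ℕ (λ i → i < length xs × at xs i ≡ x)
∈-at (x ∷ xs) (here refl) = 0 , s≤s z≤n , refl
∈-at (x ∷ xs) (there p) with ∈-at xs p
... | i , lt , e = suc i , s≤s lt , e

at-injective : ∀ xs i j → Unique xs → i < length xs → j < length xs → at xs i ≡ at xs j → i ≡ j
at-injective (x ∷ xs) zero zero u _ _ _ = refl
at-injective (x ∷ xs) zero (suc j) (a ∷ u) _ (s≤s lj) e = ⊥-elim (All.lookup a (at-∈ xs j lj) e)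
at-injective (x ∷ xs) (suc i) zero (a ∷ u) (s≤s li) _ e = ⊥-elim (All.lookup a (at-∈ xs i li) (sym e))
at-injective (x ∷ xs) (suc i) (suc j) (a ∷ u) (s≤s li) (s≤s lj) e = cong suc (at-injective xs i j u li lj e)

at-split : ∀ (P Q : List ℕ) y a → length P ≡ a → at (P ++ y ∷ Q) a ≡ y
at-split P Q y a l = subst (λ k → at (P ++ y ∷ Q) k ≡ y) l
    (trans (cong (at (P ++ y ∷ Q)) (sym (+-identityʳ (length P)))) (at-++ʳ P (y ∷ Q) 0))

split-at : ∀ xs i → i < length xs → xs ≡ take i xs ++ at xs i ∷ drop (suc i) xs
split-at (x ∷ xs) zero _ = refl
split-at (x ∷ xs) (suc i) (s≤s lt) = cong (x ∷_) (split-at xs i lt)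

nth-split : ∀ (w : List ℕ) j y → 1 ≤ j → j ≤ length w → nth w j ≡ y → w ≡ take (j ∸ 1) w ++ y ∷ drop j w
nth-split w (suc j) y _ le e = subst (λ z → w ≡ take j w ++ z ∷ drop (suc j) w) e (split-at w j le)

length-snoc : ∀ {A : Set} (r : List A) z → length (r ++ [ z ]) ≡ suc (length r)
length-snoc r z = trans (length-++ r) (+-comm (length r) 1)

at-snoc : ∀ r z i → i < length r → at (r ++ [ z ]) i ≡ at r i
at-snoc r z i lt = at-++ˡ r [ z ] i lt

at-snoc-last : ∀ r z → at (r ++ [ z ]) (length r) ≡ z
at-snoc-last r z = trans (cong (at (r ++ [ z ])) (sym (+-identityʳ (length r)))) (at-++ʳ r [ z ] 0)

at-drop : ∀ (xs : List ℕ) r i → at (drop r xs) i ≡ at xs (r + i)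
at-drop xs zero i = refl
at-drop [] (suc r) i = refl
at-drop (x ∷ xs) (suc r) i = at-drop xs r i

at-take : ∀ (xs : List ℕ) r i → i < r → at (take r xs) i ≡ at xs i
at-take [] (suc r) i lt = refl
at-take (x ∷ xs) (suc r) zero lt = refl
at-take (x ∷ xs) (suc r) (suc i) (s≤s lt) = at-take xs r i lt

at-applyUpTo : ∀ (f : ℕ → ℕ) n m → m < n → at (applyUpTo f n) m ≡ f m
at-applyUpTo f (suc n) zero _ = refl
at-applyUpTo f (suc n) (suc m) (s≤s lt) = at-applyUpTo (f ∘′ suc) n m lt
  where open import Function.Base using (_∘′_)

at-map-upTo : ∀ (f : ℕ → ℕ) n m → m < n → at (map f (upTo n)) m ≡ f m
at-map-upTo f n m lt = trans (cong (λ z → at z m) (map-upTo f n)) (at-applyUpTo f n m lt)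

at-extensional : ∀ (xs ys : List ℕ) → length xs ≡ length ys → (∀ i → i < length xs → at xs i ≡ at ys i) → xs ≡ ys
at-extensional [] [] _ _ = refl
at-extensional (x ∷ xs) (y ∷ ys) l h = cong₂ _∷_ (h 0 (s≤s z≤n)) (at-extensional xs ys (suc-injective l) (λ i lt → h (suc i) (s≤s lt)))

reverse-take++drop : ∀ k (ys : List ℕ) → reverse ys ≡ reverse (drop k ys) ++ reverse (take k ys)
reverse-take++drop k ys = trans (cong reverse (sym (take++drop≡id k ys))) (reverse-++ (take k ys) (drop k ys))

length-reverse-drop : ∀ (ys : List ℕ) {t} → t ≤ length ys → length (reverse (drop (length ys ∸ t) ys)) ≡ t
length-reverse-drop ys {t} t≤ = trans (length-reverse (drop (length ys ∸ t) ys)) (trans (length-drop (length ys ∸ t) ys) (m∸[m∸n]≡n t≤))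

take-reverse : ∀ (ys : List ℕ) t → Σ ℕ (λ k → take t (reverse ys) ≡ reverse (drop k ys))
take-reverse ys t with t ≤? length ys
... | yes t≤ = k , trans (cong (take t) (reverse-take++drop k ys))
                     (subst (λ i → take i (reverse (drop k ys) ++ reverse (take k ys)) ≡ reverse (drop k ys))
                       (length-reverse-drop ys t≤) (take-length-++ (reverse (drop k ys)) _))
  where k = length ys ∸ t
... | no t≰ = 0 , take-all t (reverse ys) (≤-trans (≤-reflexive (length-reverse ys)) (<⇒≤ (≰⇒> t≰)))

drop-reverse : ∀ (ys : List ℕ) t → Σ ℕ (λ k → k ≤ length ys × drop t (reverse ys) ≡ reverse (take k ys))
drop-reverse ys t with t ≤? length ys
... | yes t≤ = k , m∸n≤m (length ys) t , trans (cong (drop t) (reverse-take++drop k ys))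
                     (subst (λ i → drop i (reverse (drop k ys) ++ reverse (take k ys)) ≡ reverse (take k ys))
                       (length-reverse-drop ys t≤) (drop-length-++ (reverse (drop k ys)) _))
  where k = length ys ∸ t
... | no t≰ = 0 , z≤n , drop-all t (reverse ys) (≤-trans (≤-reflexive (length-reverse ys)) (<⇒≤ (≰⇒> t≰)))

unique-resp-↭ : ∀ {xs ys : List ℕ} → xs ↭ ys → Unique xs → Unique ys
unique-resp-↭ p = Unique-resp-↭ (↭⇒↭ₛ p)

unique-++-disjoint : ∀ (A B : List ℕ) → Unique (A ++ B) → ∀ {x} → x ∈ A → x ∈ B → ⊥
unique-++-disjoint (a ∷ A) B (h ∷ u) (here refl) q = All.lookup h (∈-++⁺ʳ A q) refl
unique-++-disjoint (a ∷ A) B (h ∷ u) (there p) q = unique-++-disjoint A B u p q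

unique-++⁻ˡ : ∀ (A B : List ℕ) → Unique (A ++ B) → Unique A
unique-++⁻ˡ A B u = subst Unique (take-length-++ A B) (UP.take⁺ (length A) u)

unique-++⁻ʳ : ∀ (A B : List ℕ) → Unique (A ++ B) → Unique B
unique-++⁻ʳ A B u = subst Unique (drop-length-++ A B) (UP.drop⁺ (length A) u)

unique-++⁺ : ∀ (A B : List ℕ) → Unique A → Unique B → (∀ {x} → x ∈ A → x ∈ B → ⊥) → Unique (A ++ B)
unique-++⁺ A B ua ub d = UP.++⁺ ua ub (λ { (p , q) → d p q })

Unique-reverse : ∀ xs → Unique xs → Unique (reverse xs)
Unique-reverse xs u = unique-resp-↭ (↭-sym (↭-reverse xs)) u

All-reverse⁺ : ∀ {p} {P : Pred ℕ p} xs → All P xs → All P (reverse xs)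
All-reverse⁺ xs a = All-resp-↭ (↭-sym (↭-reverse xs)) a

All-reverse⁻ : ∀ {p} {P : Pred ℕ p} xs → All P (reverse xs) → All P xs
All-reverse⁻ xs a = All-resp-↭ (↭-reverse xs) a

map-unique-on : ∀ {A : Set} (f : A → List ℕ) (xs : List A) → Unique xs →
  (∀ {x y} → x ∈ xs → y ∈ xs → f x ≡ f y → x ≡ y) → Unique (map f xs)
map-unique-on f [] _ _ = []
map-unique-on f (x ∷ xs) (x∉xs ∷ u) inj =
  All.tabulate fx∉ ∷ map-unique-on f xs u (λ p q e → inj (there p) (there q) e)
  where
  fx∉ : ∀ {z} → z ∈ map f xs → f x ≢ z
  fx∉ p e with ∈-map⁻ f p
  ... | y , q , refl = All.lookup x∉xs q (inj (here refl) (there q) e)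

filter-map-suc : ∀ {p} {P : Pred ℕ p} (P? : Decidable P) xs →
  filter P? (map suc xs) ≡ map suc (filter (λ i → P? (suc i)) xs)
filter-map-suc P? [] = refl
filter-map-suc P? (x ∷ xs) with does (P? (suc x))
... | true = cong (suc x ∷_) (filter-map-suc P? xs)
... | false = filter-map-suc P? xs

filter-cons : ∀ {p} {P : Pred ℕ p} (P? : Decidable P) x xs →
  filter P? (x ∷ xs) ≡ (if does (P? x) then x ∷ filter P? xs else filter P? xs)
filter-cons P? x xs with does (P? x)
... | true = refl
... | false = refl

filter-cong : ∀ {p q} {P : Pred ℕ p} {Q : Pred ℕ q} (P? : Decidable P) (Q? : Decidable Q) xs →
  (∀ x → x ∈ xs → does (P? x) ≡ does (Q? x)) → filter P? xs ≡ filter Q? xs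
filter-cong P? Q? [] h = refl
filter-cong P? Q? (x ∷ xs) h
  rewrite filter-cons P? x xs | filter-cons Q? x xs | h x (here refl)
        | filter-cong P? Q? xs (λ y p → h y (there p)) = refl

≡ᵇ-refl : ∀ n → (n ≡ᵇ n) ≡ true
≡ᵇ-refl n = to T-≡ (≡⇒≡ᵇ n n refl)

≢⇒≡ᵇ≡false : ∀ m n → m ≢ n → (m ≡ᵇ n) ≡ false
≢⇒≡ᵇ≡false m n m≢n with m ≡ᵇ n | ≡ᵇ⇒≡ m n
... | false | _ = refl
... | true | m≡n = ⊥-elim (m≢n (m≡n _))

range1-suc : ∀ m → range1 (suc m) ≡ 1 ∷ map suc (range1 m)
range1-suc m = cong (λ z → 1 ∷ map suc z) (sym (map-upTo suc m))

range1-snoc : ∀ m → range1 (suc m) ≡ range1 m ++ [ suc m ]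
range1-snoc m = trans (cong (map suc) (sym (upTo-∷ʳ m))) (map-++ suc (upTo m) [ m ])

-- Sets of consecutive integers

Interval : ℕ → ℕ → ℕ → Set
Interval lo k x = lo ≤ x × x < lo + k

infix 4 _≐_
_≐_ : List ℕ → (ℕ → Set) → Set
xs ≐ P = ∀ x → x ∈ xs ⇔ P x

IsInterval : List ℕ → Set
IsInterval xs = Σ ℕ λ c → Σ ℕ λ s → xs ≐ Interval c s

IntervalIn : ℕ → ℕ → List ℕ → Set
IntervalIn lo hi xs = Σ ℕ λ c → Σ ℕ λ s → lo ≤ c × c + s ≤ hi × xs ≐ Interval c s

interval : ℕ → ℕ → List ℕ
interval lo k = applyUpTo (lo +_) k

∈-interval⁻ : ∀ {lo k x} → x ∈ interval lo k → Interval lo k x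
∈-interval⁻ {lo} p with ∈-applyUpTo⁻ (lo +_) p
... | i , i<k , refl = m≤m+n lo i , +-monoʳ-< lo i<k

∈-interval⁺ : ∀ {lo k x} → Interval lo k x → x ∈ interval lo k
∈-interval⁺ {lo} {k} (lo≤x , x<lo+k) =
  subst (_∈ interval lo k) (m+[n∸m]≡n lo≤x)
    (∈-applyUpTo⁺ (lo +_) (+-cancelˡ-< lo _ _ (subst (_< lo + k) (sym (m+[n∸m]≡n lo≤x)) x<lo+k)))

interval-unique : ∀ lo k → Unique (interval lo k)
interval-unique lo k = UP.applyUpTo⁺₁ (lo +_) k (λ i<j _ eq → <⇒≢ i<j (+-cancelˡ-≡ lo _ _ eq))

range1≡interval : ∀ n → range1 n ≡ interval 1 n
range1≡interval n = map-upTo suc n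

∈-range1⁻ : ∀ {m i} → i ∈ range1 m → 1 ≤ i × i ≤ m
∈-range1⁻ {m} {i} p rewrite range1≡interval m = proj₁ (∈-interval⁻ p) , ≤-pred (proj₂ (∈-interval⁻ p))

≐interval⇒↭ : ∀ {xs lo k} → Unique xs → xs ≐ Interval lo k → xs ↭ interval lo k
≐interval⇒↭ {lo = lo} {k} u h = ∼bag⇒↭ (unique∧set⇒bag u (interval-unique lo k)
  (λ {x} → mk⇔ (λ p → ∈-interval⁺ (to (h x) p)) (λ p → from (h x) (∈-interval⁻ p))))

≐interval⇒length : ∀ {xs lo k} → Unique xs → xs ≐ Interval lo k → length xs ≡ k
≐interval⇒length {lo = lo} {k} u h = trans (↭-length (≐interval⇒↭ u h)) (length-applyUpTo (lo +_) k)

isPerm⁻ : ∀ {n w} → IsPerm n w → Unique w × w ≐ Interval 1 n × length w ≡ n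
isPerm⁻ {n} p rewrite range1≡interval n =
  unique-resp-↭ (↭-sym p) (interval-unique 1 n) ,
  (λ x → mk⇔ (λ q → ∈-interval⁻ (∈-resp-↭ p q)) (λ q → ∈-resp-↭ (↭-sym p) (∈-interval⁺ q))) ,
  trans (↭-length p) (length-applyUpTo (1 +_) n)

isPerm⁺ : ∀ {n w} → Unique w → w ≐ Interval 1 n → IsPerm n w
isPerm⁺ {n} u h rewrite range1≡interval n = ≐interval⇒↭ u h

[]-elems : ∀ lo → [] ≐ Interval lo 0
[]-elems lo x = mk⇔ (λ ()) (λ { (a , b) → ⊥-elim (<-irrefl refl (<-≤-trans b (subst (_≤ x) (sym (+-identityʳ lo)) a))) })

≐-reverse : ∀ ys {P : ℕ → Set} → ys ≐ P → reverse ys ≐ P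
≐-reverse ys h x = mk⇔ (λ p → to (h x) (AnyP.reverse⁻ p)) (λ q → AnyP.reverse⁺ (from (h x) q))

≐-head-max : ∀ {z t lo k} → z ∷ t ≐ Interval lo (suc k) → All (_< z) t → z ≡ lo + k × t ≐ Interval lo k
≐-head-max {z} {t} {lo} {k} h t<z = z≡ , elems
  where
  z≡ : z ≡ lo + k
  z≡ with from (h (lo + k)) (m≤m+n lo k , +-monoʳ-< lo (n<1+n k))
  ... | here e = sym e
  ... | there p = ⊥-elim (<-irrefl refl (<-≤-trans (All.lookup t<z p) (≤-pred (subst (z <_) (+-suc lo k) (proj₂ (to (h z) (here refl)))))))
  elems : t ≐ Interval lo k
  elems x = mk⇔ (λ p → proj₁ (to (h x) (there p)) , subst (x <_) z≡ (All.lookup t<z p)) g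
    where
    g : Interval lo k x → x ∈ t
    g (lo≤x , x<) with from (h x) (lo≤x , <-trans x< (+-monoʳ-< lo (n<1+n k)))
    ... | here e = ⊥-elim (<-irrefl (trans e z≡) x<)
    ... | there p = p

≐-head-min : ∀ {z t lo k} → z ∷ t ≐ Interval lo (suc k) → All (z <_) t → z ≡ lo × t ≐ Interval (suc lo) k
≐-head-min {z} {t} {lo} {k} h z<t = z≡ , elems
  where
  z≡ : z ≡ lo
  z≡ with from (h lo) (≤-refl , m<m+n lo (s≤s z≤n))
  ... | here e = sym e
  ... | there p = ⊥-elim (<-irrefl refl (<-≤-trans (All.lookup z<t p) (proj₁ (to (h z) (here refl)))))
  elems : t ≐ Interval (suc lo) k
  elems x = mk⇔ (λ p → subst (_< x) z≡ (All.lookup z<t p) , subst (x <_) (+-suc lo k) (proj₂ (to (h x) (there p)))) g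
    where
    g : Interval (suc lo) k x → x ∈ t
    g (lo<x , x<) with from (h x) (<⇒≤ lo<x , subst (x <_) (sym (+-suc lo k)) x<)
    ... | here e = ⊥-elim (<-irrefl (sym (trans e z≡)) lo<x)
    ... | there p = p

insertMax⁺ : ∀ m A B → Unique (B ++ A) → B ++ A ≐ Interval 1 m →
  Unique (A ++ suc m ∷ B) × A ++ suc m ∷ B ≐ Interval 1 (suc m)
insertMax⁺ m A B u h = unique-++⁺ A (suc m ∷ B) (unique-++⁻ʳ B A u) (All.tabulate n∉B ∷ unique-++⁻ˡ B A u) disjoint , elems
  where
  n∉ : suc m ∉ B ++ A
  n∉ p = <-irrefl refl (proj₂ (to (h (suc m)) p))
  n∉B : ∀ {x} → x ∈ B → suc m ≢ x
  n∉B p refl = n∉ (∈-++⁺ˡ p)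
  disjoint : ∀ {x} → x ∈ A → x ∈ suc m ∷ B → ⊥
  disjoint p (here refl) = n∉ (∈-++⁺ʳ B p)
  disjoint p (there q) = unique-++-disjoint B A u q p
  below : ∀ {x} → x ∈ B ++ A → Interval 1 (suc m) x
  below {x} p = proj₁ (to (h x) p) , <-trans (proj₂ (to (h x) p)) (n<1+n _)
  elems : A ++ suc m ∷ B ≐ Interval 1 (suc m)
  elems x = mk⇔ f g
    where
    f : x ∈ A ++ suc m ∷ B → Interval 1 (suc m) x
    f p with ∈-++⁻ A p
    ... | inj₁ q = below (∈-++⁺ʳ B q)
    ... | inj₂ (here refl) = s≤s z≤n , ≤-refl
    ... | inj₂ (there q) = below (∈-++⁺ˡ q)
    g : Interval 1 (suc m) x → x ∈ A ++ suc m ∷ B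
    g (1≤x , x≤n) with m≤n⇒m<n∨m≡n (≤-pred x≤n)
    ... | inj₂ refl = ∈-++⁺ʳ A (here refl)
    ... | inj₁ x<n with ∈-++⁻ B (from (h x) (1≤x , x<n))
    ...   | inj₁ q = ∈-++⁺ʳ A (there q)
    ...   | inj₂ q = ∈-++⁺ˡ q

insertMax⁻ : ∀ m A B → Unique (A ++ suc m ∷ B) → A ++ suc m ∷ B ≐ Interval 1 (suc m) →
  Unique (B ++ A) × B ++ A ≐ Interval 1 m
insertMax⁻ m A B u h = unique-++⁺ B A uB (unique-++⁻ˡ A (suc m ∷ B) u) (λ p q → unique-++-disjoint A (suc m ∷ B) u q (there p)) , elems
  where
  uB : Unique B
  uB = UP.drop⁺ 1 (unique-++⁻ʳ A (suc m ∷ B) u)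
  n∉B : suc m ∉ B
  n∉B q with unique-++⁻ʳ A (suc m ∷ B) u
  ... | n≢B ∷ _ = All.lookup n≢B q refl
  n∉ : suc m ∉ B ++ A
  n∉ p with ∈-++⁻ B p
  ... | inj₁ q = n∉B q
  ... | inj₂ q = unique-++-disjoint A (suc m ∷ B) u q (here refl)
  below : ∀ {x} → x ∈ B ++ A → Interval 1 (suc m) x → Interval 1 m x
  below p (1≤x , x≤n) with m≤n⇒m<n∨m≡n (≤-pred x≤n)
  ... | inj₁ x<n = 1≤x , x<n
  ... | inj₂ refl = ⊥-elim (n∉ p)
  elems : B ++ A ≐ Interval 1 m
  elems x = mk⇔ f g
    where
    f : x ∈ B ++ A → Interval 1 m x
    f p with ∈-++⁻ B p
    ... | inj₁ q = below p (to (h x) (∈-++⁺ʳ A (there q)))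
    ... | inj₂ q = below p (to (h x) (∈-++⁺ˡ q))
    g : Interval 1 m x → x ∈ B ++ A
    g (1≤x , x<n) with ∈-++⁻ A (from (h x) (1≤x , <-trans x<n (n<1+n _)))
    ... | inj₁ p = ∈-++⁺ʳ B p
    ... | inj₂ (here refl) = ⊥-elim (<-irrefl refl x<n)
    ... | inj₂ (there p) = ∈-++⁺ˡ p

-- Descent sets

desBits : List ℕ → List Bool
desBits [] = []
desBits (x ∷ []) = []
desBits (x ∷ y ∷ r) = does (y <? x) ∷ desBits (y ∷ r)

trues : ℕ → List Bool → List ℕ
trues k [] = []
trues k (true ∷ bs) = k ∷ trues (suc k) bs
trues k (false ∷ bs) = trues (suc k) bs

length-desBits : ∀ xs → length (desBits xs) ≡ length xs ∸ 1
length-desBits [] = refl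
length-desBits (x ∷ []) = refl
length-desBits (x ∷ y ∷ r) = cong suc (length-desBits (y ∷ r))

trues-suc : ∀ k bs → trues (suc k) bs ≡ map suc (trues k bs)
trues-suc k [] = refl
trues-suc k (true ∷ bs) = cong (suc k ∷_) (trues-suc (suc k) bs)
trues-suc k (false ∷ bs) = trues-suc (suc k) bs

trues-++ : ∀ k bs cs → trues k (bs ++ cs) ≡ trues k bs ++ trues (k + length bs) cs
trues-++ k [] cs = cong (λ z → trues z cs) (sym (+-identityʳ k))
trues-++ k (true ∷ bs) cs = cong (k ∷_) (trans (trues-++ (suc k) bs cs)
      (cong (λ z → trues (suc k) bs ++ trues z cs) (sym (+-suc k (length bs)))))
trues-++ k (false ∷ bs) cs = trans (trues-++ (suc k) bs cs) (cong (λ z → trues (suc k) bs ++ trues z cs) (sym (+-suc k (length bs))))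

trues-bounds : ∀ k bs {x} → x ∈ trues k bs → k ≤ x × x < k + length bs
trues-bounds k (true ∷ bs) (here refl) = ≤-refl , subst (k <_) (sym (+-suc k _)) (s≤s (m≤m+n k _))
trues-bounds k (true ∷ bs) {x} (there p) with trues-bounds (suc k) bs p
... | a , b = <⇒≤ a , subst (x <_) (sym (+-suc k (length bs))) b
trues-bounds k (false ∷ bs) {x} p with trues-bounds (suc k) bs p
... | a , b = <⇒≤ a , subst (x <_) (sym (+-suc k (length bs))) b

trues-injective : ∀ k bs cs → length bs ≡ length cs → trues k bs ≡ trues k cs → bs ≡ cs
trues-injective k [] [] _ _ = refl
trues-injective k (true ∷ bs) (true ∷ cs) l e = cong (true ∷_) (trues-injective (suc k) bs cs (suc-injective l) (∷-injectiveʳ e))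
trues-injective k (false ∷ bs) (false ∷ cs) l e = cong (false ∷_) (trues-injective (suc k) bs cs (suc-injective l) e)
trues-injective k (true ∷ bs) (false ∷ cs) l e = ⊥-elim (<-irrefl refl (proj₁ (trues-bounds (suc k) cs (subst (k ∈_) e (here refl)))))
trues-injective k (false ∷ bs) (true ∷ cs) l e = ⊥-elim (<-irrefl refl (proj₁ (trues-bounds (suc k) bs (subst (k ∈_) (sym e) (here refl)))))

trues-shift : ∀ j k bs → map (_∸ j) (trues (j + k) bs) ≡ trues k bs
trues-shift j k [] = refl
trues-shift j k (true ∷ bs) = cong₂ _∷_ (m+n∸m≡n j k)
    (trans (cong (λ z → map (_∸ j) (trues z bs)) (sym (+-suc j k))) (trues-shift j (suc k) bs))
trues-shift j k (false ∷ bs) = trans (cong (λ z → map (_∸ j) (trues z bs)) (sym (+-suc j k))) (trues-shift j (suc k) bs)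

trues-single : ∀ k c → trues k [ c ] ≡ (if c then [ k ] else [])
trues-single k true = refl
trues-single k false = refl

Des-∷-∷ : ∀ x y r →
  Des (x ∷ y ∷ r) ≡ (if does (y <? x) then 1 ∷ map suc (Des (y ∷ r)) else map suc (Des (y ∷ r)))
Des-∷-∷ x y r =
  begin
    Des (x ∷ y ∷ r)
  ≡⟨ cong (filter D) (range1-suc (length r)) ⟩
    filter D (1 ∷ map suc (range1 (length r)))
  ≡⟨ filter-cons D 1 _ ⟩
    (if does (y <? x) then 1 ∷ filter D (map suc (range1 (length r))) else filter D (map suc (range1 (length r))))
  ≡⟨ cong (λ z → if does (y <? x) then 1 ∷ z else z) shift ⟩
    (if does (y <? x) then 1 ∷ map suc (Des (y ∷ r)) else map suc (Des (y ∷ r)))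
  ∎
  where
  open ≡-Reasoning
  D : Decidable (λ i → nth (x ∷ y ∷ r) (suc i) < nth (x ∷ y ∷ r) i)
  D i = nth (x ∷ y ∷ r) (suc i) <? nth (x ∷ y ∷ r) i
  D′ : Decidable (λ i → nth (y ∷ r) (suc i) < nth (y ∷ r) i)
  D′ i = nth (y ∷ r) (suc i) <? nth (y ∷ r) i
  shift : filter D (map suc (range1 (length r))) ≡ map suc (Des (y ∷ r))
  shift = begin
      filter D (map suc (map suc (upTo (length r))))
    ≡⟨ filter-map-suc D (map suc (upTo (length r))) ⟩
      map suc (filter (λ i → D (suc i)) (map suc (upTo (length r))))
    ≡⟨ cong (map suc) (filter-map-suc (λ i → D (suc i)) (upTo (length r))) ⟩
      map suc (map suc (filter (λ i → D (suc (suc i))) (upTo (length r))))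
    ≡⟨ cong (map suc) (sym (filter-map-suc D′ (upTo (length r)))) ⟩
      map suc (Des (y ∷ r))
    ∎

Des≡trues : ∀ xs → Des xs ≡ trues 1 (desBits xs)
Des≡trues [] = refl
Des≡trues (x ∷ []) = refl
Des≡trues (x ∷ y ∷ r) =
  trans (Des-∷-∷ x y r)
        (step (does (y <? x)) (trans (cong (map suc) (Des≡trues (y ∷ r))) (sym (trues-suc 1 (desBits (y ∷ r))))))
  where
  step : ∀ b {ds} → ds ≡ trues 2 (desBits (y ∷ r)) →
    (if b then 1 ∷ ds else ds) ≡ trues 1 (b ∷ desBits (y ∷ r))
  step true e = cong (1 ∷_) e
  step false e = e

Des≡⇒desBits≡ : ∀ X Y → length X ≡ length Y → Des X ≡ Des Y → desBits X ≡ desBits Y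
Des≡⇒desBits≡ X Y l e = trues-injective 1 (desBits X) (desBits Y)
    (trans (length-desBits X) (trans (cong (_∸ 1) l) (sym (length-desBits Y))))
  (trans (sym (Des≡trues X)) (trans e (Des≡trues Y)))

desBits-++-prefix : ∀ A ys → Σ (List Bool) (λ R → desBits (A ++ ys) ≡ desBits A ++ R)
desBits-++-prefix [] ys = desBits ys , refl
desBits-++-prefix (x ∷ []) ys = desBits (x ∷ ys) , refl
desBits-++-prefix (x ∷ x' ∷ A) ys with desBits-++-prefix (x' ∷ A) ys
... | R , e = R , cong (does (x' <? x) ∷_) e

length-desBits-∷ʳ : ∀ A y → length (desBits (A ++ [ y ])) ≡ length A
length-desBits-∷ʳ A y = trans (length-desBits (A ++ [ y ])) (cong (_∸ 1) (length-snoc A y))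

desBits-++-∷ : ∀ xs y ys → desBits (xs ++ y ∷ ys) ≡ desBits (xs ++ [ y ]) ++ desBits (y ∷ ys)
desBits-++-∷ [] y ys = refl
desBits-++-∷ (x ∷ []) y ys = refl
desBits-++-∷ (x ∷ x' ∷ xs) y ys = cong (does (x' <? x) ∷_) (desBits-++-∷ (x' ∷ xs) y ys)

Des-prefix : ∀ A y B K → K ≡ length A ∸ 1 → filter (λ i → i ≤? K) (Des (A ++ y ∷ B)) ≡ Des A
Des-prefix A y B K eK with desBits-++-prefix A (y ∷ B)
... | R , e rewrite Des≡trues (A ++ y ∷ B) | Des≡trues A | e | trues-++ 1 (desBits A) R
    | filter-++ (λ i → i ≤? K) (trues 1 (desBits A)) (trues (1 + length (desBits A)) R) =
  trans (cong₂ _++_ (filter-all (λ i → i ≤? K) (All.tabulate (λ {x} p → lo x p)))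
             (filter-none (λ i → i ≤? K) (All.tabulate (λ {x} p → hi x p)))) (++-identityʳ _)
  where
  L = length (desBits A)
  eL : L ≡ K
  eL = trans (length-desBits A) (sym eK)
  lo : ∀ x → x ∈ trues 1 (desBits A) → x ≤ K
  lo x p = subst (x ≤_) eL (≤-pred (proj₂ (trues-bounds 1 (desBits A) p)))
  hi : ∀ x → x ∈ trues (1 + L) R → ¬ (x ≤ K)
  hi x p le = <-irrefl refl (≤-trans (proj₁ (trues-bounds (1 + L) R p)) (subst (x ≤_) (sym eL) le))

Des-suffix : ∀ A y B j → j ≡ suc (length A) →
  map (λ i → i ∸ j) (filter (λ i → j <? i) (Des (A ++ y ∷ B))) ≡ Des B
Des-suffix A y [] j ej rewrite Des≡trues (A ++ [ y ]) =
  cong (map (λ i → i ∸ j)) (filter-none (λ i → j <? i) (All.tabulate (λ {x} p → hi x p)))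
  where
  hi : ∀ x → x ∈ trues 1 (desBits (A ++ [ y ])) → ¬ (j < x)
  hi x p lt = <-asym lt (subst (x <_) (trans (cong suc (length-desBits-∷ʳ A y)) (sym ej)) (proj₂ (trues-bounds 1 (desBits (A ++ [ y ])) p)))
Des-suffix A y (b ∷ B) j ej =
  begin
    map (λ i → i ∸ j) (filter (λ i → j <? i) (Des (A ++ y ∷ b ∷ B)))
  ≡⟨ cong (λ z → map (λ i → i ∸ j) (filter (λ i → j <? i) z)) (trans (Des≡trues (A ++ y ∷ b ∷ B)) (cong (trues 1) fe)) ⟩
    map (λ i → i ∸ j) (filter (λ i → j <? i) (trues 1 (C ++ desBits (b ∷ B))))
  ≡⟨ cong (λ z → map (λ i → i ∸ j) (filter (λ i → j <? i) z)) (trues-++ 1 C (desBits (b ∷ B))) ⟩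
    map (λ i → i ∸ j) (filter (λ i → j <? i) (trues 1 C ++ trues (1 + length C) (desBits (b ∷ B))))
  ≡⟨ cong (map (λ i → i ∸ j)) (filter-++ (λ i → j <? i) (trues 1 C) _) ⟩
    map (λ i → i ∸ j) (filter (λ i → j <? i) (trues 1 C) ++ filter (λ i → j <? i) (trues (1 + length C) (desBits (b ∷ B))))
  ≡⟨ cong₂ (λ u v → map (λ i → i ∸ j) (u ++ v)) (filter-none (λ i → j <? i) (All.tabulate (λ {x} p → hi x p)))
      (filter-all (λ i → j <? i) (All.tabulate (λ {x} p → lo x p))) ⟩
    map (λ i → i ∸ j) (trues (1 + length C) (desBits (b ∷ B)))
  ≡⟨ cong (λ z → map (λ i → i ∸ j) (trues z (desBits (b ∷ B)))) (trans (cong suc eC) (+-comm 1 j)) ⟩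
    map (λ i → i ∸ j) (trues (j + 1) (desBits (b ∷ B)))
  ≡⟨ trues-shift j 1 (desBits (b ∷ B)) ⟩
    trues 1 (desBits (b ∷ B))
  ≡⟨ sym (Des≡trues (b ∷ B)) ⟩
    Des (b ∷ B)
  ∎
  where
  open ≡-Reasoning
  C = desBits (A ++ [ y ]) ++ [ does (b <? y) ]
  fe : desBits (A ++ y ∷ b ∷ B) ≡ C ++ desBits (b ∷ B)
  fe = trans (desBits-++-∷ A y (b ∷ B)) (sym (++-assoc (desBits (A ++ [ y ])) [ does (b <? y) ] (desBits (b ∷ B))))
  eC : length C ≡ j
  eC = trans (length-snoc (desBits (A ++ [ y ])) (does (b <? y))) (trans (cong suc (length-desBits-∷ʳ A y)) (sym ej))
  hi : ∀ x → x ∈ trues 1 C → ¬ (j < x)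
  hi x p lt = <-irrefl refl (≤-trans lt (subst (x ≤_) eC (≤-pred (proj₂ (trues-bounds 1 C p)))))
  lo : ∀ x → x ∈ trues (1 + length C) (desBits (b ∷ B)) → j < x
  lo x p = subst (_≤ x) (cong suc eC) (proj₁ (trues-bounds (1 + length C) (desBits (b ∷ B)) p))

cyclicBit : ℕ → List ℕ → Bool
cyclicBit n w = does (nth w 1 <? nth w n)

cDes≡trues : ∀ n w → length w ≡ n → 1 ≤ n → cDes n w ≡ trues 1 (desBits w ++ [ cyclicBit n w ])
cDes≡trues (suc m) w lw _ =
  begin
    filter C (range1 (suc m))
  ≡⟨ cong (filter C) (range1-snoc m) ⟩
    filter C (range1 m ++ [ suc m ])
  ≡⟨ filter-++ C (range1 m) [ suc m ] ⟩
    filter C (range1 m) ++ filter C [ suc m ]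
  ≡⟨ cong₂ _++_ e1 e2 ⟩
    trues 1 (desBits w) ++ trues (1 + length (desBits w)) [ cyclicBit (suc m) w ]
  ≡⟨ sym (trues-++ 1 (desBits w) [ cyclicBit (suc m) w ]) ⟩
    trues 1 (desBits w ++ [ cyclicBit (suc m) w ])
  ∎
  where
  open ≡-Reasoning
  C : Decidable (λ i → nth w (csucc (suc m) i) < nth w i)
  C = λ i → nth w (csucc (suc m) i) <? nth w i
  D : Decidable (λ i → nth w (suc i) < nth w i)
  D = λ i → nth w (suc i) <? nth w i
  ℓ≡m : length (desBits w) ≡ m
  ℓ≡m = trans (length-desBits w) (cong (_∸ 1) lw)
  e1 : filter C (range1 m) ≡ trues 1 (desBits w)
  e1 = trans (filter-cong C D (range1 m) h) (trans (cong (λ z → filter D (range1 z)) (sym (cong (_∸ 1) lw))) (Des≡trues w))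
    where
    h : ∀ x → x ∈ range1 m → does (C x) ≡ does (D x)
    h x p rewrite ≢⇒≡ᵇ≡false x (suc m) (λ e → <-irrefl refl (subst (_≤ m) e (proj₂ (∈-range1⁻ p)))) = refl
  e2 : filter C [ suc m ] ≡ trues (1 + length (desBits w)) [ cyclicBit (suc m) w ]
  e2 rewrite ℓ≡m | trues-single (suc m) (cyclicBit (suc m) w) | filter-cons C (suc m) [] with does (C (suc m)) | lem
    where
    lem : does (C (suc m)) ≡ cyclicBit (suc m) w
    lem rewrite ≡ᵇ-refl m = refl
  ... | b | refl = refl

cDes≡⇒desBits≡ : ∀ n w w' → length w ≡ n → length w' ≡ n → 1 ≤ n → cDes n w ≡ cDes n w' →
  desBits w ≡ desBits w' × cyclicBit n w ≡ cyclicBit n w'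
cDes≡⇒desBits≡ n w w' l l' le e =
  ∷ʳ-injective (desBits w) (desBits w')
    (trues-injective 1 _ _ (trans (length-++ (desBits w))
            (trans (cong (_+ 1) (trans (length-desBits w) (trans (cong (_∸ 1) l) (sym (trans (length-desBits w') (cong (_∸ 1) l'))))))
                  (sym (length-++ (desBits w')))))
      (trans (sym (cDes≡trues n w l le)) (trans e (cDes≡trues n w' l' le))))

n∈?cDes≡cyclicBit : ∀ n w → length w ≡ n → 1 ≤ n → does (n ∈? cDes n w) ≡ cyclicBit n w
n∈?cDes≡cyclicBit n w lw le rewrite cDes≡trues n w lw le | trues-++ 1 (desBits w) [ cyclicBit n w ] with cyclicBit n w
... | true = dec-true (n ∈? _) (∈-++⁺ʳ (trues 1 (desBits w)) (subst (λ z → n ∈ trues z [ true ]) (sym 1+ℓ≡n) (here refl)))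
  where
  1+ℓ≡n : 1 + length (desBits w) ≡ n
  1+ℓ≡n = trans (cong suc (trans (length-desBits w) (cong (_∸ 1) lw))) (m+[n∸m]≡n le)
... | false = dec-false (n ∈? _) λ p → <-irrefl refl
    (subst (n <_) 1+ℓ≡n (proj₂ (trues-bounds 1 (desBits w) (subst (n ∈_) (++-identityʳ _) p))))
  where
  1+ℓ≡n : 1 + length (desBits w) ≡ n
  1+ℓ≡n = trans (cong suc (trans (length-desBits w) (cong (_∸ 1) lw))) (m+[n∸m]≡n le)

posOf-++-∷ : ∀ n A B → n ∉ A → posOf n (A ++ n ∷ B) ≡ suc (length A)
posOf-++-∷ n [] B _ rewrite ≡ᵇ-refl n = refl
posOf-++-∷ n (a ∷ A) B ni rewrite ≢⇒≡ᵇ≡false n a (λ e → ni (here e)) = cong suc (posOf-++-∷ n A B (λ p → ni (there p)))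

consIfNonEmpty : Bool → List ℕ → List Bool → List Bool
consIfNonEmpty b [] fs = []
consIfNonEmpty b (_ ∷ _) fs = b ∷ fs

consIfNonEmpty-∷ : ∀ b xs fs → 0 < length xs → consIfNonEmpty b xs fs ≡ b ∷ fs
consIfNonEmpty-∷ b (_ ∷ _) fs _ = refl

desBits-∷-max : ∀ h xs → All (_< h) xs → desBits (h ∷ xs) ≡ consIfNonEmpty true xs (desBits xs)
desBits-∷-max h [] _ = refl
desBits-∷-max h (y ∷ r) (a ∷ _) = cong (_∷ desBits (y ∷ r)) (dec-true (y <? h) a)

desBits-∷-min : ∀ h xs → All (h <_) xs → desBits (h ∷ xs) ≡ consIfNonEmpty false xs (desBits xs)
desBits-∷-min h [] _ = refl
desBits-∷-min h (y ∷ r) (a ∷ _) = cong (_∷ desBits (y ∷ r)) (dec-false (y <? h) (<-asym a))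

reverseBits : List Bool → List Bool
reverseBits bs = reverse (map not bs)

length-reverseBits : ∀ bs → length (reverseBits bs) ≡ length bs
length-reverseBits bs = trans (length-reverse (map not bs)) (length-map not bs)

reverseBits-involutive : ∀ bs → reverseBits (reverseBits bs) ≡ bs
reverseBits-involutive bs = trans (cong reverse (reverse-map not (map not bs)))
  (trans (reverse-involutive (map not (map not bs)))
    (trans (sym (map-∘ bs)) (trans (map-cong not-involutive bs) (map-id bs))))

<?-flip : ∀ x y → x ≢ y → does (x <? y) ≡ not (does (y <? x))
<?-flip x y ne with <-cmp x y
... | tri< a _ _ = trans (dec-true (x <? y) a) (cong not (sym (dec-false (y <? x) (<-asym a))))
... | tri≈ _ e _ = ⊥-elim (ne e)
... | tri> _ _ c = trans (dec-false (x <? y) (<-asym c)) (cong not (sym (dec-true (y <? x) c)))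

reverseBits-∷ : ∀ b bs → reverseBits (b ∷ bs) ≡ reverseBits bs ++ [ not b ]
reverseBits-∷ b bs = unfold-reverse (not b) (map not bs)

desBits-reverse : ∀ xs → Unique xs → desBits (reverse xs) ≡ reverseBits (desBits xs)
desBits-reverse [] _ = refl
desBits-reverse (x ∷ []) _ = refl
desBits-reverse (x ∷ y ∷ r) ((x≢y ∷ _) ∷ u) =
  begin
    desBits (reverse (x ∷ y ∷ r))
  ≡⟨ cong desBits e ⟩
    desBits (reverse r ++ y ∷ [ x ])
  ≡⟨ desBits-++-∷ (reverse r) y [ x ] ⟩
    desBits (reverse r ++ [ y ]) ++ [ does (x <? y) ]
  ≡⟨ cong (λ z → desBits z ++ [ does (x <? y) ]) (sym (unfold-reverse y r)) ⟩
    desBits (reverse (y ∷ r)) ++ [ does (x <? y) ]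
  ≡⟨ cong₂ (λ a b → a ++ [ b ]) (desBits-reverse (y ∷ r) u) (<?-flip x y x≢y) ⟩
    reverseBits (desBits (y ∷ r)) ++ [ not (does (y <? x)) ]
  ≡⟨ sym (reverseBits-∷ (does (y <? x)) (desBits (y ∷ r))) ⟩
    reverseBits (desBits (x ∷ y ∷ r))
  ∎
  where
  open ≡-Reasoning
  e : reverse (x ∷ y ∷ r) ≡ reverse r ++ y ∷ [ x ]
  e = trans (unfold-reverse x (y ∷ r)) (trans (cong (_++ [ x ]) (unfold-reverse y r)) (++-assoc (reverse r) [ y ] [ x ]))

-- Unimodal arrangements

ExtremalHeads : List ℕ → Set
ExtremalHeads [] = ⊤
ExtremalHeads (z ∷ ys) = (All (_< z) ys ⊎ All (z <_) ys) × ExtremalHeads ys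

LeftUnimodal₀ : List ℕ → Set
LeftUnimodal₀ xs = ∀ p q → 0 < p → p < q → q < length xs →
  (at xs 0 < at xs p → at xs 0 < at xs q → at xs p < at xs q) ×
  (at xs p < at xs 0 → at xs q < at xs 0 → at xs q < at xs p)

LeftUnimodal⇒₀ : ∀ xs → LeftUnimodal xs → LeftUnimodal₀ xs
LeftUnimodal⇒₀ xs lu p q a b c = lu (suc p) (suc q) (s≤s a) (s≤s b) c

₀⇒LeftUnimodal : ∀ xs → LeftUnimodal₀ xs → LeftUnimodal xs
₀⇒LeftUnimodal xs lu (suc p) (suc q) (s≤s a) (s≤s b) c = lu p q a b c

LeftUnimodal₀-∷ʳ : ∀ r z → LeftUnimodal₀ r → (All (_< z) r ⊎ All (z <_) r) → LeftUnimodal₀ (r ++ [ z ])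
LeftUnimodal₀-∷ʳ r z lu c p q 0<p p<q q< with m≤n⇒m<n∨m≡n (≤-pred (subst (suc q ≤_) (length-snoc r z) q<))
... | inj₁ q<r rewrite at-snoc r z 0 (<-trans 0<p (<-trans p<q q<r)) | at-snoc r z p (<-trans p<q q<r)
                   | at-snoc r z q q<r = lu p q 0<p p<q q<r
... | inj₂ refl rewrite at-snoc r z 0 (<-trans 0<p p<q) | at-snoc r z p p<q | at-snoc-last r z with c
...   | inj₁ a = (λ _ _ → All.lookup a (at-∈ r p p<q)) , (λ h1 h2 → ⊥-elim (<-asym h2 (All.lookup a (at-∈ r 0 (<-trans 0<p p<q)))))
...   | inj₂ a = (λ h1 h2 → ⊥-elim (<-asym h2 (All.lookup a (at-∈ r 0 (<-trans 0<p p<q))))) , (λ _ _ → All.lookup a (at-∈ r p p<q))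

LeftUnimodal₀-init : ∀ r z → LeftUnimodal₀ (r ++ [ z ]) → LeftUnimodal₀ r
LeftUnimodal₀-init r z lu p q 0<p p<q q<r with lu p q 0<p p<q (subst (q <_) (sym (length-snoc r z)) (<-trans q<r (n<1+n _)))
... | h rewrite at-snoc r z 0 (<-trans 0<p (<-trans p<q q<r)) | at-snoc r z p (<-trans p<q q<r) | at-snoc r z q q<r = h

LeftUnimodal₀-last : ∀ r z → Unique r → All (z ≢_) r → LeftUnimodal₀ (r ++ [ z ]) → All (_< z) r ⊎ All (z <_) r
LeftUnimodal₀-last [] z u a lu = inj₁ []
LeftUnimodal₀-last (x ∷ r') z u a lu with <-cmp x z
... | tri≈ _ e _ = ⊥-elim (All.lookup a (here refl) (sym e))
... | tri< x<z _ _ = inj₁ (All.tabulate (λ {x} p → h x p))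
  where
  r = x ∷ r'
  h : ∀ y → y ∈ r → y < z
  h y p with ∈-at r p
  ... | zero , _ , refl = x<z
  ... | suc i , lt , refl with lu (suc i) (length r) (s≤s z≤n) lt (subst (length r <_) (sym (length-snoc r z)) (n<1+n _))
  ...   | A , B rewrite at-snoc r z (suc i) lt | at-snoc-last r z with <-cmp (at r (suc i)) x
  ...     | tri< y<x _ _ = <-trans y<x x<z
  ...     | tri≈ _ e _ = ⊥-elim (0≢1+n (sym (at-injective r (suc i) 0 u lt (s≤s z≤n) e)))
  ...     | tri> _ _ x<y = A x<y x<z
... | tri> _ _ z<x = inj₂ (All.tabulate (λ {x} p → h x p))
  where
  r = x ∷ r'
  h : ∀ y → y ∈ r → z < y
  h y p with ∈-at r p
  ... | zero , _ , refl = z<x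
  ... | suc i , lt , refl with lu (suc i) (length r) (s≤s z≤n) lt (subst (length r <_) (sym (length-snoc r z)) (n<1+n _))
  ...   | A , B rewrite at-snoc r z (suc i) lt | at-snoc-last r z with <-cmp (at r (suc i)) x
  ...     | tri< y<x _ _ = B y<x z<x
  ...     | tri≈ _ e _ = ⊥-elim (0≢1+n (sym (at-injective r (suc i) 0 u lt (s≤s z≤n) e)))
  ...     | tri> _ _ x<y = <-trans z<x x<y

ExtremalHeads⇒LeftUnimodal₀-reverse : ∀ ys → ExtremalHeads ys → LeftUnimodal₀ (reverse ys)
ExtremalHeads⇒LeftUnimodal₀-reverse [] _ p q _ _ ()
ExtremalHeads⇒LeftUnimodal₀-reverse (z ∷ ys) (c , h) =
  subst LeftUnimodal₀ (sym (unfold-reverse z ys))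
    (LeftUnimodal₀-∷ʳ (reverse ys) z (ExtremalHeads⇒LeftUnimodal₀-reverse ys h) (Sum.map (All-reverse⁺ ys) (All-reverse⁺ ys) c))

LeftUnimodal₀-reverse⇒ExtremalHeads : ∀ ys → Unique ys → LeftUnimodal₀ (reverse ys) → ExtremalHeads ys
LeftUnimodal₀-reverse⇒ExtremalHeads [] _ _ = tt
LeftUnimodal₀-reverse⇒ExtremalHeads (z ∷ ys) (a ∷ u) lu = c , LeftUnimodal₀-reverse⇒ExtremalHeads ys u
    (LeftUnimodal₀-init (reverse ys) z lu')
  where
  lu' : LeftUnimodal₀ (reverse ys ++ [ z ])
  lu' = subst LeftUnimodal₀ (unfold-reverse z ys) lu
  c : All (_< z) ys ⊎ All (z <_) ys
  c = Sum.map (All-reverse⁻ ys) (All-reverse⁻ ys) (LeftUnimodal₀-last (reverse ys) z (Unique-reverse ys u) (All-reverse⁺ ys a) lu')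

ExtremalHeads⇒RightUnimodal : ∀ xs → ExtremalHeads xs → RightUnimodal xs
ExtremalHeads⇒RightUnimodal xs h = ₀⇒LeftUnimodal (reverse xs) (ExtremalHeads⇒LeftUnimodal₀-reverse xs h)

RightUnimodal⇒ExtremalHeads : ∀ xs → Unique xs → RightUnimodal xs → ExtremalHeads xs
RightUnimodal⇒ExtremalHeads xs u h = LeftUnimodal₀-reverse⇒ExtremalHeads xs u (LeftUnimodal⇒₀ (reverse xs) h)

ExtremalHeads-reverse⇒LeftUnimodal : ∀ xs → ExtremalHeads (reverse xs) → LeftUnimodal xs
ExtremalHeads-reverse⇒LeftUnimodal xs h = subst LeftUnimodal (reverse-involutive xs)
    (₀⇒LeftUnimodal (reverse (reverse xs)) (ExtremalHeads⇒LeftUnimodal₀-reverse (reverse xs) h))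

LeftUnimodal⇒ExtremalHeads-reverse : ∀ xs → Unique xs → LeftUnimodal xs → ExtremalHeads (reverse xs)
LeftUnimodal⇒ExtremalHeads-reverse xs u h = LeftUnimodal₀-reverse⇒ExtremalHeads (reverse xs) (Unique-reverse xs u)
    (LeftUnimodal⇒₀ (reverse (reverse xs)) (subst LeftUnimodal (sym (reverse-involutive xs)) h))

ruArrange₁ : ℕ → List Bool → List ℕ
ruArrange₁ lo [] = [ lo ]
ruArrange₁ lo (true ∷ ds) = (lo + suc (length ds)) ∷ ruArrange₁ lo ds
ruArrange₁ lo (false ∷ ds) = lo ∷ ruArrange₁ (suc lo) ds

length-ruArrange₁ : ∀ lo ds → length (ruArrange₁ lo ds) ≡ suc (length ds)
length-ruArrange₁ lo [] = refl
length-ruArrange₁ lo (true ∷ ds) = cong suc (length-ruArrange₁ lo ds)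
length-ruArrange₁ lo (false ∷ ds) = cong suc (length-ruArrange₁ (suc lo) ds)

ruArrange₁-elems : ∀ lo ds → ruArrange₁ lo ds ≐ Interval lo (suc (length ds))
ruArrange₁-elems lo [] x = mk⇔ f g
  where
  f : x ∈ [ lo ] → Interval lo 1 x
  f (here refl) = ≤-refl , subst (lo <_) (+-comm 1 lo) ≤-refl
  g : Interval lo 1 x → x ∈ [ lo ]
  g (a , b) = here (≤-antisym (≤-pred (subst (x <_) (+-comm lo 1) b)) a)
ruArrange₁-elems lo (true ∷ ds) x = mk⇔ f g
  where
  L = length ds
  f : x ∈ ruArrange₁ lo (true ∷ ds) → Interval lo (suc (suc L)) x
  f (here refl) = m≤m+n lo (suc L) , +-monoʳ-< lo (n<1+n (suc L))
  f (there p) with to (ruArrange₁-elems lo ds x) p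
  ... | a , b = a , <-trans b (+-monoʳ-< lo (n<1+n (suc L)))
  g : Interval lo (suc (suc L)) x → x ∈ ruArrange₁ lo (true ∷ ds)
  g (a , b) with m≤n⇒m<n∨m≡n (≤-pred (subst (x <_) (+-suc lo (suc L)) b))
  ... | inj₁ lt = there (from (ruArrange₁-elems lo ds x) (a , lt))
  ... | inj₂ e = here e
ruArrange₁-elems lo (false ∷ ds) x = mk⇔ f g
  where
  L = length ds
  f : x ∈ ruArrange₁ lo (false ∷ ds) → Interval lo (suc (suc L)) x
  f (here refl) = ≤-refl , m<m+n lo (s≤s z≤n)
  f (there p) with to (ruArrange₁-elems (suc lo) ds x) p
  ... | a , b = <⇒≤ a , subst (x <_) (sym (+-suc lo (suc L))) b
  g : Interval lo (suc (suc L)) x → x ∈ ruArrange₁ lo (false ∷ ds)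
  g (a , b) with m≤n⇒m<n∨m≡n a
  ... | inj₁ lt = there (from (ruArrange₁-elems (suc lo) ds x) (lt , subst (x <_) (+-suc lo (suc L)) b))
  ... | inj₂ e = here (sym e)

ruArrange₁-unique : ∀ lo ds → Unique (ruArrange₁ lo ds)
ruArrange₁-unique lo [] = [] ∷ []
ruArrange₁-unique lo (true ∷ ds) =
  All.tabulate (λ {y} p e → <-irrefl (sym e) (proj₂ (to (ruArrange₁-elems lo ds y) p))) ∷ ruArrange₁-unique lo ds
ruArrange₁-unique lo (false ∷ ds) =
  All.tabulate (λ {y} p e → <-irrefl e (proj₁ (to (ruArrange₁-elems (suc lo) ds y) p))) ∷ ruArrange₁-unique (suc lo) ds

ruArrange₁-< : ∀ lo ds → All (_< lo + suc (length ds)) (ruArrange₁ lo ds)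
ruArrange₁-< lo ds = All.tabulate (λ {y} p → proj₂ (to (ruArrange₁-elems lo ds y) p))

ruArrange₁-≥ : ∀ lo ds → All (lo ≤_) (ruArrange₁ lo ds)
ruArrange₁-≥ lo ds = All.tabulate (λ {y} p → proj₁ (to (ruArrange₁-elems lo ds y) p))

desBits-ruArrange₁ : ∀ lo ds → desBits (ruArrange₁ lo ds) ≡ ds
desBits-ruArrange₁ lo [] = refl
desBits-ruArrange₁ lo (true ∷ ds) =
  trans (desBits-∷-max _ (ruArrange₁ lo ds) (ruArrange₁-< lo ds))
    (trans (consIfNonEmpty-∷ true (ruArrange₁ lo ds) _ (subst (0 <_) (sym (length-ruArrange₁ lo ds)) (s≤s z≤n)))
          (cong (true ∷_) (desBits-ruArrange₁ lo ds)))
desBits-ruArrange₁ lo (false ∷ ds) =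
  trans (desBits-∷-min lo (ruArrange₁ (suc lo) ds) (ruArrange₁-≥ (suc lo) ds))
    (trans (consIfNonEmpty-∷ false (ruArrange₁ (suc lo) ds) _ (subst (0 <_) (sym (length-ruArrange₁ (suc lo) ds)) (s≤s z≤n)))
          (cong (false ∷_) (desBits-ruArrange₁ (suc lo) ds)))

ruArrange₁-extremalHeads : ∀ lo ds → ExtremalHeads (ruArrange₁ lo ds)
ruArrange₁-extremalHeads lo [] = inj₁ [] , tt
ruArrange₁-extremalHeads lo (true ∷ ds) = inj₁ (ruArrange₁-< lo ds) , ruArrange₁-extremalHeads lo ds
ruArrange₁-extremalHeads lo (false ∷ ds) = inj₂ (ruArrange₁-≥ (suc lo) ds) , ruArrange₁-extremalHeads (suc lo) ds

ruArrange₁-suffix : ∀ lo ds t → IntervalIn lo (lo + suc (length ds)) (drop t (ruArrange₁ lo ds))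
ruArrange₁-suffix lo ds zero = lo , suc (length ds) , ≤-refl , ≤-refl , ruArrange₁-elems lo ds
ruArrange₁-suffix lo [] (suc t) =
  lo , 0 , ≤-refl , ≤-trans (≤-reflexive (+-identityʳ lo)) (m≤m+n lo 1) , subst (_≐ Interval lo 0) (sym (drop-[] t)) ([]-elems lo)
ruArrange₁-suffix lo (true ∷ ds) (suc t) with ruArrange₁-suffix lo ds t
... | c , s , a , b , h = c , s , a , ≤-trans b (+-monoʳ-≤ lo (n≤1+n _)) , h
ruArrange₁-suffix lo (false ∷ ds) (suc t) with ruArrange₁-suffix (suc lo) ds t
... | c , s , a , b , h = c , s , <⇒≤ a , ≤-trans b (≤-reflexive (sym (+-suc lo (suc (length ds))))) , h

ruArrange₁-canonical : ∀ r lo → Unique r → r ≐ Interval lo (length r) → ExtremalHeads r → 0 < length r →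
  r ≡ ruArrange₁ lo (desBits r)
ruArrange₁-canonical (z ∷ []) lo u h _ _ with from (h lo) (≤-refl , subst (lo <_) (+-comm 1 lo) ≤-refl)
... | here e = cong (_∷ []) (sym e)
ruArrange₁-canonical (z ∷ y ∷ r) lo (_ ∷ u) h (inj₁ z>r , er) _ rewrite desBits-∷-max z (y ∷ r) z>r =
  cong₂ _∷_ (trans (proj₁ top) (cong (λ k → lo + suc k) (sym (length-desBits (y ∷ r)))))
      (ruArrange₁-canonical (y ∷ r) lo u (proj₂ top) er (s≤s z≤n))
  where top = ≐-head-max h z>r
ruArrange₁-canonical (z ∷ y ∷ r) lo (_ ∷ u) h (inj₂ z<r , er) _ rewrite desBits-∷-min z (y ∷ r) z<r =
  cong₂ _∷_ (proj₁ bottom) (ruArrange₁-canonical (y ∷ r) (suc lo) u (proj₂ bottom) er (s≤s z≤n))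
  where bottom = ≐-head-min h z<r

luArrange₁ : ℕ → List Bool → List ℕ
luArrange₁ lo bs = reverse (ruArrange₁ lo (reverseBits bs))

length-luArrange₁ : ∀ lo bs → length (luArrange₁ lo bs) ≡ suc (length bs)
length-luArrange₁ lo bs = trans (length-reverse (ruArrange₁ lo (reverseBits bs)))
    (trans (length-ruArrange₁ lo (reverseBits bs)) (cong suc (length-reverseBits bs)))

luArrange₁-elems : ∀ lo bs → luArrange₁ lo bs ≐ Interval lo (suc (length bs))
luArrange₁-elems lo bs = subst (λ k → luArrange₁ lo bs ≐ Interval lo (suc k)) (length-reverseBits bs)
    (≐-reverse (ruArrange₁ lo (reverseBits bs)) (ruArrange₁-elems lo (reverseBits bs)))

luArrange₁-unique : ∀ lo bs → Unique (luArrange₁ lo bs)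
luArrange₁-unique lo bs = Unique-reverse _ (ruArrange₁-unique lo (reverseBits bs))

desBits-luArrange₁ : ∀ lo bs → desBits (luArrange₁ lo bs) ≡ bs
desBits-luArrange₁ lo bs = trans (desBits-reverse (ruArrange₁ lo (reverseBits bs)) (ruArrange₁-unique lo (reverseBits bs)))
    (trans (cong reverseBits (desBits-ruArrange₁ lo (reverseBits bs))) (reverseBits-involutive bs))

luArrange₁-leftUnimodal : ∀ lo bs → LeftUnimodal (luArrange₁ lo bs)
luArrange₁-leftUnimodal lo bs = ExtremalHeads-reverse⇒LeftUnimodal (luArrange₁ lo bs)
    (subst ExtremalHeads (sym (reverse-involutive _)) (ruArrange₁-extremalHeads lo (reverseBits bs)))

luArrange₁-prefix : ∀ lo bs t → IntervalIn lo (lo + suc (length bs)) (take t (luArrange₁ lo bs))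
luArrange₁-prefix lo bs t with take-reverse (ruArrange₁ lo (reverseBits bs)) t
... | k , e with ruArrange₁-suffix lo (reverseBits bs) k
... | c , s , a , b , h = c , s , a , subst (λ z → c + s ≤ lo + suc z) (length-reverseBits bs) b ,
      subst (_≐ Interval c s) (sym e) (≐-reverse _ h)

luArrange₁-canonical : ∀ xs lo → Unique xs → xs ≐ Interval lo (length xs) → LeftUnimodal xs → 0 < length xs →
  xs ≡ luArrange₁ lo (desBits xs)
luArrange₁-canonical xs lo u h l ne =
  begin
    xs
  ≡⟨ sym (reverse-involutive xs) ⟩
    reverse (reverse xs)
  ≡⟨ cong reverse (ruArrange₁-canonical (reverse xs) lo (Unique-reverse xs u) hr (LeftUnimodal⇒ExtremalHeads-reverse xs u l)
        (subst (0 <_) (sym (length-reverse xs)) ne)) ⟩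
    reverse (ruArrange₁ lo (desBits (reverse xs)))
  ≡⟨ cong (λ z → reverse (ruArrange₁ lo z)) (desBits-reverse xs u) ⟩
    luArrange₁ lo (desBits xs)
  ∎
  where
  open ≡-Reasoning
  hr : reverse xs ≐ Interval lo (length (reverse xs))
  hr = subst (λ k → reverse xs ≐ Interval lo k) (sym (length-reverse xs)) (≐-reverse xs h)

luArrange : ℕ → ℕ → List Bool → List ℕ
luArrange lo zero bs = []
luArrange lo (suc m) bs = luArrange₁ lo bs

ruArrange : ℕ → ℕ → List Bool → List ℕ
ruArrange lo zero bs = []
ruArrange lo (suc m) bs = ruArrange₁ lo bs

leftUnimodal-[] : LeftUnimodal []
leftUnimodal-[] (suc (suc p)) (suc (suc (suc q))) (s≤s (s≤s _)) (s≤s (s≤s _)) ()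

bs≡[] : ∀ (bs : List Bool) → length bs ≡ 0 → bs ≡ []
bs≡[] [] _ = refl

length-luArrange : ∀ lo m bs → length bs ≡ m ∸ 1 → length (luArrange lo m bs) ≡ m
length-luArrange lo zero bs _ = refl
length-luArrange lo (suc m) bs e = trans (length-luArrange₁ lo bs) (cong suc e)

length-ruArrange : ∀ lo m bs → length bs ≡ m ∸ 1 → length (ruArrange lo m bs) ≡ m
length-ruArrange lo zero bs _ = refl
length-ruArrange lo (suc m) bs e = trans (length-ruArrange₁ lo bs) (cong suc e)

luArrange-elems : ∀ lo m bs → length bs ≡ m ∸ 1 → luArrange lo m bs ≐ Interval lo m
luArrange-elems lo zero bs _ = []-elems lo
luArrange-elems lo (suc m) bs e = subst (λ k → luArrange₁ lo bs ≐ Interval lo (suc k)) e (luArrange₁-elems lo bs)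

ruArrange-elems : ∀ lo m bs → length bs ≡ m ∸ 1 → ruArrange lo m bs ≐ Interval lo m
ruArrange-elems lo zero bs _ = []-elems lo
ruArrange-elems lo (suc m) bs e = subst (λ k → ruArrange₁ lo bs ≐ Interval lo (suc k)) e (ruArrange₁-elems lo bs)

luArrange-unique : ∀ lo m bs → Unique (luArrange lo m bs)
luArrange-unique lo zero bs = []
luArrange-unique lo (suc m) bs = luArrange₁-unique lo bs

ruArrange-unique : ∀ lo m bs → Unique (ruArrange lo m bs)
ruArrange-unique lo zero bs = []
ruArrange-unique lo (suc m) bs = ruArrange₁-unique lo bs

desBits-luArrange : ∀ lo m bs → length bs ≡ m ∸ 1 → desBits (luArrange lo m bs) ≡ bs
desBits-luArrange lo zero bs e = sym (bs≡[] bs e)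
desBits-luArrange lo (suc m) bs e = desBits-luArrange₁ lo bs

desBits-ruArrange : ∀ lo m bs → length bs ≡ m ∸ 1 → desBits (ruArrange lo m bs) ≡ bs
desBits-ruArrange lo zero bs e = sym (bs≡[] bs e)
desBits-ruArrange lo (suc m) bs e = desBits-ruArrange₁ lo bs

luArrange-leftUnimodal : ∀ lo m bs → LeftUnimodal (luArrange lo m bs)
luArrange-leftUnimodal lo zero bs = leftUnimodal-[]
luArrange-leftUnimodal lo (suc m) bs = luArrange₁-leftUnimodal lo bs

ruArrange-rightUnimodal : ∀ lo m bs → RightUnimodal (ruArrange lo m bs)
ruArrange-rightUnimodal lo zero bs = leftUnimodal-[]
ruArrange-rightUnimodal lo (suc m) bs = ExtremalHeads⇒RightUnimodal (ruArrange₁ lo bs) (ruArrange₁-extremalHeads lo bs)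

luArrange-prefix : ∀ lo m bs → length bs ≡ m ∸ 1 → ∀ t → IntervalIn lo (lo + m) (take t (luArrange lo m bs))
luArrange-prefix lo zero bs _ t = lo , 0 , ≤-refl , ≤-refl , subst (_≐ Interval lo 0) (sym (take-[] t)) ([]-elems lo)
luArrange-prefix lo (suc m) bs e t with luArrange₁-prefix lo bs t
... | c , s , a , b , h = c , s , a , subst (λ k → c + s ≤ lo + suc k) e b , h

ruArrange-suffix : ∀ lo m bs → length bs ≡ m ∸ 1 → ∀ t → IntervalIn lo (lo + m) (drop t (ruArrange lo m bs))
ruArrange-suffix lo zero bs _ t = lo , 0 , ≤-refl , ≤-refl , subst (_≐ Interval lo 0) (sym (drop-[] t)) ([]-elems lo)
ruArrange-suffix lo (suc m) bs e t with ruArrange₁-suffix lo bs t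
... | c , s , a , b , h = c , s , a , subst (λ k → c + s ≤ lo + suc k) e b , h

luArrange-canonical : ∀ xs lo m → Unique xs → xs ≐ Interval lo m → LeftUnimodal xs → xs ≡ luArrange lo m (desBits xs)
luArrange-canonical xs lo m u h l with ≐interval⇒length u h
luArrange-canonical [] lo .0 u h l | refl = refl
luArrange-canonical (x ∷ xs) lo .(suc (length xs)) u h l | refl = luArrange₁-canonical (x ∷ xs) lo u h l (s≤s z≤n)

ruArrange-canonical : ∀ xs lo m → Unique xs → xs ≐ Interval lo m → RightUnimodal xs → xs ≡ ruArrange lo m (desBits xs)
ruArrange-canonical xs lo m u h l with ≐interval⇒length u h
ruArrange-canonical [] lo .0 u h l | refl = refl
ruArrange-canonical (x ∷ xs) lo .(suc (length xs)) u h l | refl = ruArrange₁-canonical (x ∷ xs) lo u h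
    (RightUnimodal⇒ExtremalHeads (x ∷ xs) u l) (s≤s z≤n)

suffixIntervals⇒ExtremalHeads : ∀ Y → Unique Y → (∀ t → IsInterval (drop t Y)) → ExtremalHeads Y
suffixIntervals⇒ExtremalHeads [] _ _ = tt
suffixIntervals⇒ExtremalHeads (z ∷ Y) (az ∷ uY) h = cz , suffixIntervals⇒ExtremalHeads Y uY (λ t → h (suc t))
  where
  c = proj₁ (h 0)
  s = proj₁ (proj₂ (h 0))
  h0 : z ∷ Y ≐ Interval c s
  h0 = proj₂ (proj₂ (h 0))
  c' = proj₁ (h 1)
  s' = proj₁ (proj₂ (h 1))
  h1 : Y ≐ Interval c' s'
  h1 = proj₂ (proj₂ (h 1))
  zin : Interval c s z
  zin = to (h0 z) (here refl)
  cz : All (_< z) Y ⊎ All (z <_) Y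
  cz with m≤n⇒m<n∨m≡n (proj₁ zin)
  ... | inj₂ e = inj₂ (All.tabulate (λ {y} p → ≤∧≢⇒< (subst (_≤ y) e (proj₁ (to (h0 y) (there p)))) (λ e' → All.lookup az p e')))
  ... | inj₁ c<z with suc z <? c + s
  ...   | no nb = inj₁ (All.tabulate (λ {y} p → ≤∧≢⇒< (≤-pred (<-≤-trans (proj₂ (to (h0 y) (there p))) (≮⇒≥ nb)))
          (λ e' → All.lookup az p (sym e'))))
  ...   | yes sz = ⊥-elim (All.lookup az zY refl)
    where
    cY : c ∈ Y
    cY with from (h0 c) (≤-refl , <-trans c<z (proj₂ zin))
    ... | here e = ⊥-elim (<-irrefl e c<z)
    ... | there p = p
    szY : suc z ∈ Y
    szY with from (h0 (suc z)) (≤-trans (<⇒≤ c<z) (n≤1+n z) , sz)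
    ... | here e = ⊥-elim (<-irrefl (sym e) (n<1+n z))
    ... | there p = p
    zY : z ∈ Y
    zY = from (h1 z) (≤-trans (proj₁ (to (h1 c) cY)) (<⇒≤ c<z) , <-trans (n<1+n z) (proj₂ (to (h1 (suc z)) szY)))

-- Rotations

rotation : (n : ℕ) → .{{NonZero n}} → ℕ → List ℕ
rotation n k = map (λ i → suc ((i + k) % n)) (upTo n)

[1+m%n]%n≡[1+m]%n : ∀ a n .{{_ : NonZero n}} → suc (a % n) % n ≡ suc a % n
[1+m%n]%n≡[1+m]%n a n = trans (%-distribˡ-+ 1 (a % n) n) (trans (cong (λ z → (1 % n + z) % n) (m%n%n≡m%n a n)) (sym (%-distribˡ-+ 1 a n)))

pow-cyc≡rotation : ∀ n .{{_ : NonZero n}} k → pow n (cyc n) k ≡ rotation n k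
pow-cyc≡rotation n zero = map-cong-local (All.tabulate
      (λ {i} p → cong suc (sym (trans (cong (_% n) (+-identityʳ i)) (m<n⇒m%n≡m (∈-upTo⁻ p))))))
pow-cyc≡rotation n (suc k) rewrite pow-cyc≡rotation n k =
  trans (sym (map-∘ (upTo n)))
    (map-cong-local (All.tabulate (λ {i} p →
      trans (at-map-upTo (λ i → suc (suc i % n)) n ((i + k) % n) (m%n<n (i + k) n))
        (cong suc (trans ([1+m%n]%n≡[1+m]%n (i + k) n) (cong (_% n) (sym (+-suc i k))))))))

[m+n]%o≡[m+n%o]%o : ∀ i k n .{{_ : NonZero n}} → (i + k) % n ≡ (i + k % n) % n
[m+n]%o≡[m+n%o]%o i k n = trans (%-distribˡ-+ i k n)
    (trans (cong (λ z → (i % n + z) % n) (sym (m%n%n≡m%n k n))) (sym (%-distribˡ-+ i (k % n) n)))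

at-rotation : ∀ n .{{_ : NonZero n}} (σ : List ℕ) k → length σ ≡ n →
  map (λ i → at σ ((i + k) % n)) (upTo n) ≡ drop (k % n) σ ++ take (k % n) σ
at-rotation n σ k lσ = at-extensional _ _ l1 h
  where
  r = k % n
  r<n : r < n
  r<n = m%n<n k n
  ld : length (drop r σ) ≡ n ∸ r
  ld = trans (length-drop r σ) (cong (_∸ r) lσ)
  l1 : length (map (λ i → at σ ((i + k) % n)) (upTo n)) ≡ length (drop r σ ++ take r σ)
  l1 = trans (length-map _ (upTo n)) (trans (length-upTo n)
        (sym (trans (length-++ (drop r σ)) (trans (cong₂ _+_ ld (trans (length-take r σ) (trans (cong (r ⊓_) lσ) (m≤n⇒m⊓n≡m (<⇒≤ r<n)))))
                  (m∸n+n≡m (<⇒≤ r<n))))))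
  h : ∀ i → i < length (map (λ i → at σ ((i + k) % n)) (upTo n)) → _
  h i lt' = trans (at-map-upTo (λ i → at σ ((i + k) % n)) n i lt) (trans (cong (at σ) ([m+n]%o≡[m+n%o]%o i k n)) rhs)
    where
    lt : i < n
    lt = subst (i <_) (trans (length-map _ (upTo n)) (length-upTo n)) lt'
    rhs : at σ ((i + r) % n) ≡ at (drop r σ ++ take r σ) i
    rhs with i <? n ∸ r
    ... | yes a = sym (trans (at-++ˡ (drop r σ) (take r σ) i (subst (i <_) (sym ld) a))
                     (trans (at-drop σ r i) (cong (at σ) (trans (+-comm r i) (sym (m<n⇒m%n≡m i+r<n))))))
      where
      i+r<n : i + r < n
      i+r<n = subst (i + r <_) (m∸n+n≡m (<⇒≤ r<n)) (+-monoˡ-< r a)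
    ... | no b = sym (trans (cong (at (drop r σ ++ take r σ)) ei) (trans (at-++ʳ (drop r σ) (take r σ) i')
                     (trans (at-take σ r i' i'<r) (cong (at σ) (sym mod)))))
      where
      i' = i ∸ (n ∸ r)
      ge : n ∸ r ≤ i
      ge = ≮⇒≥ b
      ei : i ≡ length (drop r σ) + i'
      ei = trans (sym (m+[n∸m]≡n ge)) (cong (_+ i') (sym ld))
      i'<r : i' < r
      i'<r = subst (i' <_) (m∸[m∸n]≡n (<⇒≤ r<n)) (∸-monoˡ-< lt ge)
      mod : (i + r) % n ≡ i'
      mod = trans (cong (_% n) e2) (trans ([m+n]%n≡m%n i' n) (m<n⇒m%n≡m (<-trans i'<r r<n)))
        where
        e2 : i + r ≡ i' + n
        e2 = trans (cong (_+ r) (sym (m+[n∸m]≡n ge)))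
            (trans (+-assoc (n ∸ r) i' r) (trans (cong ((n ∸ r) +_) (+-comm i' r))
                    (trans (sym (+-assoc (n ∸ r) r i')) (trans (cong (_+ i') (m∸n+n≡m (<⇒≤ r<n))) (+-comm n i')))))

·-pow-cyc : ∀ n .{{_ : NonZero n}} (σ : List ℕ) k → length σ ≡ n →
  σ · pow n (cyc n) k ≡ drop (k % n) σ ++ take (k % n) σ
·-pow-cyc n σ k lσ rewrite pow-cyc≡rotation n k = trans (sym (map-∘ (upTo n))) (at-rotation n σ k lσ)

record RotatedLU (m : ℕ) (π : List ℕ) : Set where
  field
    u : List ℕ
    r : ℕ
    uu : Unique u
    uh : u ≐ Interval 1 m
    ul : LeftUnimodal u
    r≤ : r ≤ m
    eq : π ≡ drop r u ++ suc m ∷ take r u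

·-pow-cyc-∷ʳ : ∀ m u k → length u ≡ m → let n = suc m; r = k % n in
  (u ++ [ n ]) · pow n (cyc n) k ≡ drop r u ++ n ∷ take r u
·-pow-cyc-∷ʳ m u k lu =
  begin
    (u ++ [ n ]) · pow n (cyc n) k
  ≡⟨ ·-pow-cyc n (u ++ [ n ]) k (trans (length-snoc u n) (cong suc lu)) ⟩
    drop r (u ++ [ n ]) ++ take r (u ++ [ n ])
  ≡⟨ cong₂ _++_ (drop-++≤ u [ n ] r r≤) (take-++≤ u [ n ] r r≤) ⟩
    (drop r u ++ [ n ]) ++ take r u
  ≡⟨ ++-assoc (drop r u) [ n ] (take r u) ⟩
    drop r u ++ n ∷ take r u
  ∎
  where
  open ≡-Reasoning
  n = suc m
  r = k % n
  r≤ : r ≤ length u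
  r≤ = subst (r ≤_) (sym lu) (≤-pred (m%n<n k n))

InLC⇒RotatedLU : ∀ m π → InLC (suc m) π → RotatedLU m π
InLC⇒RotatedLU m π (σ , k , (pσ , σn≡n , lu) , π≡) = record
  { u = u ; r = k % n ; uu = proj₁ elems ; uh = proj₂ elems ; ul = lu ; r≤ = ≤-pred (m%n<n k n)
  ; eq = trans π≡ (trans (cong (λ z → z · pow n (cyc n) k) σ≡) (·-pow-cyc-∷ʳ m u k lenu)) }
  where
  n = suc m
  u = take m σ
  uσ = proj₁ (isPerm⁻ pσ)
  lenσ = proj₂ (proj₂ (isPerm⁻ pσ))
  lenu : length u ≡ m
  lenu = trans (length-take m σ) (trans (cong (m ⊓_) lenσ) (m≤n⇒m⊓n≡m (n≤1+n m)))
  σ≡ : σ ≡ u ++ [ n ]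
  σ≡ = trans (nth-split σ n n (s≤s z≤n) (≤-reflexive (sym lenσ)) σn≡n) (cong (λ z → u ++ n ∷ z) (drop-all n σ (≤-reflexive lenσ)))
  elems : Unique u × u ≐ Interval 1 m
  elems = insertMax⁻ m u [] (subst Unique σ≡ uσ) (subst (_≐ Interval 1 n) σ≡ (proj₁ (proj₂ (isPerm⁻ pσ))))

RotatedLU⇒InLC : ∀ m u r → Unique u → u ≐ Interval 1 m → LeftUnimodal u → r ≤ m → InLC (suc m) (drop r u ++ suc m ∷ take r u)
RotatedLU⇒InLC m u r uu uh lu r≤ = u ++ [ n ] , r , (isPerm⁺ (proj₁ elems) (proj₂ elems) , σn≡n , lσ) , sym π≡
  where
  n = suc m
  elems = insertMax⁺ m u [] uu uh
  lenu : length u ≡ m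
  lenu = ≐interval⇒length uu uh
  σn≡n : nth (u ++ [ n ]) n ≡ n
  σn≡n = trans (cong (at (u ++ [ n ])) (sym lenu)) (at-snoc-last u n)
  lσ : LeftUnimodal (take m (u ++ [ n ]))
  lσ = subst LeftUnimodal (sym (trans (cong (λ z → take z (u ++ [ n ])) (sym lenu)) (take-length-++ u [ n ]))) lu
  π≡ : (u ++ [ n ]) · pow n (cyc n) r ≡ drop r u ++ n ∷ take r u
  π≡ = subst (λ i → (u ++ [ n ]) · pow n (cyc n) r ≡ drop i u ++ n ∷ take i u) (m<n⇒m%n≡m (s≤s r≤)) (·-pow-cyc-∷ʳ m u r lenu)

-- Splitting a permutation at its maximum

record SplitAtMax (m : ℕ) (π : List ℕ) : Set where
  field
    v : List ℕ
    u' : List ℕ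
    eq : π ≡ v ++ suc m ∷ u'
    uu : Unique (u' ++ v)
    hu : u' ++ v ≐ Interval 1 m

module SplitFacts {m : ℕ} {π : List ℕ} (ns : SplitAtMax m π) where
  open SplitAtMax ns
  n = suc m
  a = length v
  b = length u'

  v∈ : ∀ {x} → x ∈ v → Interval 1 m x
  v∈ {x} p = to (hu x) (∈-++⁺ʳ u' p)

  u∈ : ∀ {x} → x ∈ u' → Interval 1 m x
  u∈ {x} p = to (hu x) (∈-++⁺ˡ p)

  v<n : All (_< n) v
  v<n = All.tabulate (λ {x} p → proj₂ (v∈ p))

  u<n : All (_< n) u'
  u<n = All.tabulate (λ {x} p → proj₂ (u∈ p))

  n∉v : n ∉ v
  n∉v p = <-irrefl refl (proj₂ (v∈ p))

  len : a + b ≡ m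
  len = trans (+-comm a b) (trans (sym (length-++ u')) (≐interval⇒length uu hu))

  uniqπ : Unique π
  uniqπ = subst Unique (sym eq) (proj₁ (insertMax⁺ m v u' uu hu))

  hasπ : π ≐ Interval 1 n
  hasπ = subst (_≐ Interval 1 n) (sym eq) (proj₂ (insertMax⁺ m v u' uu hu))

  lenπ : length π ≡ n
  lenπ = ≐interval⇒length uniqπ hasπ

  posπ : posOf n π ≡ suc a
  posπ = trans (cong (posOf n) eq) (posOf-++-∷ n v u' n∉v)

  takeπ : take (posOf n π ∸ 1) π ≡ v
  takeπ rewrite posπ | eq = take-length-++ v (n ∷ u')

  dropπ : drop (posOf n π) π ≡ u'
  dropπ rewrite posπ | eq = drop-split v u' n a refl

isPerm⇒SplitAtMax : ∀ m A B → IsPerm (suc m) (A ++ suc m ∷ B) → SplitAtMax m (A ++ suc m ∷ B)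
isPerm⇒SplitAtMax m A B p = record { v = A ; u' = B ; eq = refl ; uu = proj₁ elems ; hu = proj₂ elems }
  where elems = insertMax⁻ m A B (proj₁ (isPerm⁻ p)) (proj₁ (proj₂ (isPerm⁻ p)))

RotatedLU⇒SplitAtMax : ∀ m π → RotatedLU m π → SplitAtMax m π
RotatedLU⇒SplitAtMax m π d = record { v = drop r u ; u' = take r u ; eq = eq ; uu = subst Unique (sym (take++drop≡id r u)) uu
                     ; hu = subst (_≐ Interval 1 m) (sym (take++drop≡id r u)) uh }
  where open RotatedLU d

snocFalseIfNonEmpty : List ℕ → List Bool → List Bool
snocFalseIfNonEmpty [] fs = []
snocFalseIfNonEmpty (_ ∷ _) fs = fs ++ [ false ]

lastOf : ℕ → List ℕ → ℕ
lastOf y [] = y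
lastOf y (z ∷ B) = lastOf z B

at-last : ∀ y B → at (y ∷ B) (length B) ≡ lastOf y B
at-last y [] = refl
at-last y (z ∷ B) = at-last z B

lastOf∈ : ∀ y B → lastOf y B ∈ y ∷ B
lastOf∈ y [] = here refl
lastOf∈ y (z ∷ B) = there (lastOf∈ z B)

desBits-∷ʳ-max : ∀ A y → All (_< y) A → desBits (A ++ [ y ]) ≡ snocFalseIfNonEmpty A (desBits A)
desBits-∷ʳ-max [] y _ = refl
desBits-∷ʳ-max (x ∷ []) y (a ∷ _) = cong (_∷ []) (dec-false (y <? x) (<-asym a))
desBits-∷ʳ-max (x ∷ x' ∷ A) y (a ∷ as) = cong (does (x' <? x) ∷_) (desBits-∷ʳ-max (x' ∷ A) y as)

desBits-∷ʳ : ∀ x X y → desBits ((x ∷ X) ++ [ y ]) ≡ desBits (x ∷ X) ++ [ does (y <? lastOf x X) ]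
desBits-∷ʳ x [] y = refl
desBits-∷ʳ x (x' ∷ X) y = cong (does (x' <? x) ∷_) (desBits-∷ʳ x' X y)

splitCyclicBit : List ℕ → List ℕ → Bool
splitCyclicBit [] B = false
splitCyclicBit (x ∷ A) [] = true
splitCyclicBit (x ∷ A) (y ∷ B) = does (x <? lastOf y B)

joinBits : List ℕ → List ℕ → List Bool
joinBits [] Y = desBits Y
joinBits (x ∷ X) [] = desBits (x ∷ X)
joinBits (x ∷ X) (y ∷ Y) = desBits (x ∷ X) ++ does (y <? lastOf x X) ∷ desBits (y ∷ Y)

desBits-++ : ∀ X Y → desBits (X ++ Y) ≡ joinBits X Y
desBits-++ [] Y = refl
desBits-++ (x ∷ X) [] = cong desBits (++-identityʳ (x ∷ X))
desBits-++ (x ∷ X) (y ∷ Y) = trans (desBits-++-∷ (x ∷ X) y Y)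
  (trans (cong (_++ desBits (y ∷ Y)) (desBits-∷ʳ x X y)) (++-assoc (desBits (x ∷ X)) _ (desBits (y ∷ Y))))

desBits-++⁻ : ∀ X X' Y Y' → length X ≡ length X' → length Y ≡ length Y' → desBits (X ++ Y) ≡ desBits (X' ++ Y') →
  desBits X ≡ desBits X' × desBits Y ≡ desBits Y' × splitCyclicBit Y X ≡ splitCyclicBit Y' X'
desBits-++⁻ [] [] [] [] _ _ e = refl , refl , refl
desBits-++⁻ [] [] (y ∷ Y) (y' ∷ Y') _ _ e = refl , e , refl
desBits-++⁻ (x ∷ X) (x' ∷ X') [] [] _ _ e = trans (cong desBits (sym (++-identityʳ (x ∷ X))))
    (trans e (cong desBits (++-identityʳ (x' ∷ X')))) , refl , refl
desBits-++⁻ (x ∷ X) (x' ∷ X') (y ∷ Y) (y' ∷ Y') lx ly e with ++-injective (desBits (x ∷ X)) _ (desBits (x' ∷ X')) _ l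
    (trans (sym (desBits-++ (x ∷ X) (y ∷ Y))) (trans e (desBits-++ (x' ∷ X') (y' ∷ Y'))))
  where
  l : length (desBits (x ∷ X)) ≡ length (desBits (x' ∷ X'))
  l = trans (length-desBits (x ∷ X)) (trans (cong (_∸ 1) lx) (sym (length-desBits (x' ∷ X'))))
... | e1 , e2 = e1 , ∷-injectiveʳ e2 , ∷-injectiveˡ e2

desBits-++-cong : ∀ X X' Y Y' → length X ≡ length X' → length Y ≡ length Y' →
  desBits X ≡ desBits X' → desBits Y ≡ desBits Y' → splitCyclicBit Y X ≡ splitCyclicBit Y' X' → desBits (X ++ Y) ≡ desBits (X' ++ Y')
desBits-++-cong [] [] Y Y' _ _ _ e2 _ = e2
desBits-++-cong (x ∷ X) (x' ∷ X') [] [] _ _ e1 _ _ = trans (cong desBits (++-identityʳ (x ∷ X)))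
    (trans e1 (cong desBits (sym (++-identityʳ (x' ∷ X')))))
desBits-++-cong (x ∷ X) (x' ∷ X') (y ∷ Y) (y' ∷ Y') _ _ e1 e2 e3 =
  trans (desBits-++ (x ∷ X) (y ∷ Y)) (trans (cong₂ (λ p q → p ++ q) e1 (cong₂ _∷_ e3 e2)) (sym (desBits-++ (x' ∷ X') (y' ∷ Y'))))

length-snocFalseIfNonEmpty : ∀ A → length (snocFalseIfNonEmpty A (desBits A)) ≡ length A
length-snocFalseIfNonEmpty [] = refl
length-snocFalseIfNonEmpty (x ∷ A) = trans (length-++ (desBits (x ∷ A)) {[ false ]})
    (trans (+-comm (length (desBits (x ∷ A))) 1) (cong suc (length-desBits (x ∷ A))))

snocFalseIfNonEmpty-injective : ∀ A A' → length A ≡ length A' →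
  snocFalseIfNonEmpty A (desBits A) ≡ snocFalseIfNonEmpty A' (desBits A') → desBits A ≡ desBits A'
snocFalseIfNonEmpty-injective [] [] _ _ = refl
snocFalseIfNonEmpty-injective (x ∷ A) (x' ∷ A') _ e = proj₁ (∷ʳ-injective (desBits (x ∷ A)) (desBits (x' ∷ A')) e)

consIfNonEmpty-injective : ∀ B B' → length B ≡ length B' →
  consIfNonEmpty true B (desBits B) ≡ consIfNonEmpty true B' (desBits B') → desBits B ≡ desBits B'
consIfNonEmpty-injective [] [] _ _ = refl
consIfNonEmpty-injective (x ∷ B) (x' ∷ B') _ e = ∷-injectiveʳ e

snocFalseIfNonEmpty-cong : ∀ A A' → length A ≡ length A' → desBits A ≡ desBits A' →
  snocFalseIfNonEmpty A (desBits A) ≡ snocFalseIfNonEmpty A' (desBits A')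
snocFalseIfNonEmpty-cong [] [] _ _ = refl
snocFalseIfNonEmpty-cong (x ∷ A) (x' ∷ A') _ e = cong (_++ [ false ]) e

consIfNonEmpty-cong : ∀ B B' → length B ≡ length B' → desBits B ≡ desBits B' →
  consIfNonEmpty true B (desBits B) ≡ consIfNonEmpty true B' (desBits B')
consIfNonEmpty-cong [] [] _ _ = refl
consIfNonEmpty-cong (x ∷ B) (x' ∷ B') _ e = cong (true ∷_) e

desBits-around-max : ∀ n A B → All (_< n) A → All (_< n) B →
  desBits (A ++ n ∷ B) ≡ snocFalseIfNonEmpty A (desBits A) ++ consIfNonEmpty true B (desBits B)
desBits-around-max n A B aA aB = trans (desBits-++-∷ A n B) (cong₂ _++_ (desBits-∷ʳ-max A n aA) (desBits-∷-max n B aB))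

cyclicBit-around-max : ∀ m A B → All (_< suc m) A → All (_< suc m) B → length A + length B ≡ m →
  cyclicBit (suc m) (A ++ suc m ∷ B) ≡ splitCyclicBit A B
cyclicBit-around-max m A B aA aB l = trans (cong (λ z → does (at (A ++ suc m ∷ B) 0 <? z)) e2) (h A B aA aB)
  where
  e2 : at (A ++ suc m ∷ B) m ≡ at (suc m ∷ B) (length B)
  e2 = trans (cong (at (A ++ suc m ∷ B)) (sym l)) (at-++ʳ A (suc m ∷ B) (length B))
  h : ∀ A B → All (_< suc m) A → All (_< suc m) B → does (at (A ++ suc m ∷ B) 0 <? at (suc m ∷ B) (length B)) ≡ splitCyclicBit A B
  h [] [] _ _ = dec-false (suc m <? suc m) (<-irrefl refl)
  h [] (y ∷ B) _ aB = trans (cong (λ z → does (suc m <? z)) (at-last y B)) (dec-false (suc m <? _) (<-asym (All.lookup aB (lastOf∈ y B))))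
  h (x ∷ A) [] (ax ∷ _) _ = dec-true (x <? suc m) ax
  h (x ∷ A) (y ∷ B) _ _ = cong (λ z → does (x <? z)) (at-last y B)

-- The map φ

Interval-lower⊆ : ∀ s t x → Interval 1 s x → Interval 1 (s + t) x
Interval-lower⊆ s t x (a , b) = a , ≤-trans b (s≤s (m≤m+n s t))

Interval-upper⊆ : ∀ s t x → Interval (suc s) t x → Interval 1 (s + t) x
Interval-upper⊆ s t x (a , b) = ≤-trans (s≤s z≤n) a , b

Interval-lower-upper-disjoint : ∀ s t x → Interval 1 s x → Interval (suc s) t x → ⊥
Interval-lower-upper-disjoint s t x (a , b) (c , d) = <-irrefl refl (<-≤-trans b c)

Interval-lower-upper-cover : ∀ s t x → Interval 1 (s + t) x → Interval 1 s x ⊎ Interval (suc s) t x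
Interval-lower-upper-cover s t x (a , b) with x <? suc s
... | yes lt = inj₁ (a , lt)
... | no ge = inj₂ (≮⇒≥ ge , b)

-- The first j - 1 entries of φπ occupy [j - 1] if n ∈ cDes π and [n - 1] ∖ [n - j] otherwise;
-- prefixStart and suffixStart are the least values of the two blocks.
prefixStart : Bool → ℕ → ℕ → ℕ
prefixStart true a b = 1
prefixStart false a b = suc b

suffixStart : Bool → ℕ → ℕ → ℕ
suffixStart true a b = suc a
suffixStart false a b = 1

prefixInterval⊆ : ∀ c a b x → Interval (prefixStart c a b) a x → Interval 1 (a + b) x
prefixInterval⊆ true a b x h = Interval-lower⊆ a b x h
prefixInterval⊆ false a b x h = subst (λ k → Interval 1 k x) (+-comm b a) (Interval-upper⊆ b a x h)

suffixInterval⊆ : ∀ c a b x → Interval (suffixStart c a b) b x → Interval 1 (a + b) x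
suffixInterval⊆ true a b x h = Interval-upper⊆ a b x h
suffixInterval⊆ false a b x h = subst (λ k → Interval 1 k x) (+-comm b a) (Interval-lower⊆ b a x h)

prefix-suffix-disjoint : ∀ c a b x → Interval (prefixStart c a b) a x → Interval (suffixStart c a b) b x → ⊥
prefix-suffix-disjoint true a b x p q = Interval-lower-upper-disjoint a b x p q
prefix-suffix-disjoint false a b x p q = Interval-lower-upper-disjoint b a x q p

prefix-suffix-cover : ∀ c a b x → Interval 1 (a + b) x → Interval (prefixStart c a b) a x ⊎ Interval (suffixStart c a b) b x
prefix-suffix-cover true a b x h = Interval-lower-upper-cover a b x h
prefix-suffix-cover false a b x h with Interval-lower-upper-cover b a x (subst (λ k → Interval 1 k x) (+-comm a b) h)
... | inj₁ q = inj₂ q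
... | inj₂ p = inj₁ p

prefixInterval-bound : ∀ c a b → prefixStart c a b + a ≤ suc (a + b)
prefixInterval-bound true a b = s≤s (m≤m+n a b)
prefixInterval-bound false a b = ≤-reflexive (cong suc (+-comm b a))

suffixInterval-bound : ∀ c a b → suffixStart c a b + b ≤ suc (a + b)
suffixInterval-bound true a b = ≤-refl
suffixInterval-bound false a b = s≤s (m≤n+m b a)

prefixStart≥1 : ∀ c a b → 1 ≤ prefixStart c a b
prefixStart≥1 true a b = ≤-refl
prefixStart≥1 false a b = s≤s z≤n

suffixStart≥1 : ∀ c a b → 1 ≤ suffixStart c a b
suffixStart≥1 true a b = s≤s z≤n
suffixStart≥1 false a b = ≤-refl

suffix-elems : ∀ c a b {P Q} → Unique (Q ++ P) → Q ++ P ≐ Interval 1 (a + b) →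
  P ≐ Interval (prefixStart c a b) a → Q ≐ Interval (suffixStart c a b) b
suffix-elems c a b {P} {Q} u h hP x = mk⇔ f g
  where
  f : x ∈ Q → Interval (suffixStart c a b) b x
  f q with prefix-suffix-cover c a b x (to (h x) (∈-++⁺ˡ q))
  ... | inj₁ iv = ⊥-elim (unique-++-disjoint Q P u q (from (hP x) iv))
  ... | inj₂ iv = iv
  g : Interval (suffixStart c a b) b x → x ∈ Q
  g iv with ∈-++⁻ Q (from (h x) (suffixInterval⊆ c a b x iv))
  ... | inj₁ q = q
  ... | inj₂ p = ⊥-elim (prefix-suffix-disjoint c a b x (to (hP x) p) iv)

FirstSetᵇ : Bool → ℕ → ℕ → ℕ → Set
FirstSetᵇ c j n x = if c then (1 ≤ x × x ≤ j ∸ 1) else ((1 ≤ x × x ≤ n ∸ 1) × ¬ (1 ≤ x × x ≤ n ∸ j))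

prefixInterval⇔FirstSetᵇ : ∀ c a b x → Interval (prefixStart c a b) a x ⇔ FirstSetᵇ c (suc a) (suc (a + b)) x
prefixInterval⇔FirstSetᵇ true a b x = mk⇔ (λ { (p , q) → p , ≤-pred q }) (λ { (p , q) → p , s≤s q })
prefixInterval⇔FirstSetᵇ false a b x = mk⇔ f g
  where
  f : Interval (suc b) a x → (1 ≤ x × x ≤ a + b) × ¬ (1 ≤ x × x ≤ (a + b) ∸ a)
  f (p , q) = (≤-trans (s≤s z≤n) p , ≤-pred (subst (x <_) (cong suc (+-comm b a)) q)) ,
              λ { (_ , r) → <-irrefl refl (<-≤-trans p (subst (x ≤_) (m+n∸m≡n a b) r)) }
  g : (1 ≤ x × x ≤ a + b) × ¬ (1 ≤ x × x ≤ (a + b) ∸ a) → Interval (suc b) a x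
  g ((p , q) , r) with x ≤? b
  ... | yes le = ⊥-elim (r (p , subst (x ≤_) (sym (m+n∸m≡n a b)) le))
  ... | no gt = ≰⇒> gt , s≤s (subst (x ≤_) (+-comm a b) q)

φ-build : ℕ → Bool → List ℕ → List ℕ → List ℕ
φ-build m c v u' = luArrange (prefixStart c (length v) (length u')) (length v) (desBits v) ++ suc m ∷ ruArrange
    (suffixStart c (length v) (length u')) (length u') (desBits u')

φ : ℕ → List ℕ → List ℕ
φ m π = φ-build m (does (suc m ∈? cDes (suc m) π)) (take (posOf (suc m) π ∸ 1) π) (drop (posOf (suc m) π) π)

PhiAt : ℕ → List ℕ → List ℕ → ℕ → Set
PhiAt n π w j =
  IsPerm n w ×
  nth w j ≡ n ×
  (∀ x → (x ∈ take (j ∸ 1) w) ⇔ FirstSetᵇ (does (n ∈? cDes n π)) j n x) ×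
  LeftUnimodal (take (j ∸ 1) w) ×
  Des (take (j ∸ 1) w) ≡ filter (λ i → i ≤? j ∸ 2) (Des π) ×
  RightUnimodal (drop j w) ×
  Des (drop j w) ≡ map (λ i → i ∸ j) (filter (λ i → j <? i) (Des π))

module Construction {m : ℕ} {π : List ℕ} (ns : SplitAtMax m π) where
  open SplitAtMax ns
  open SplitFacts ns public

  c = does (n ∈? cDes n π)
  lp = prefixStart c a b
  lq = suffixStart c a b
  P = luArrange lp a (desBits v)
  Q = ruArrange lq b (desBits u')
  W = P ++ n ∷ Q

  lenP : length P ≡ a
  lenP = length-luArrange lp a (desBits v) (length-desBits v)
  lenQ : length Q ≡ b
  lenQ = length-ruArrange lq b (desBits u') (length-desBits u')
  hasP : P ≐ Interval lp a
  hasP = luArrange-elems lp a (desBits v) (length-desBits v)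
  hasQ : Q ≐ Interval lq b
  hasQ = ruArrange-elems lq b (desBits u') (length-desBits u')
  uP : Unique P
  uP = luArrange-unique lp a (desBits v)
  uQ : Unique Q
  uQ = ruArrange-unique lq b (desBits u')
  desBitsP : desBits P ≡ desBits v
  desBitsP = desBits-luArrange lp a (desBits v) (length-desBits v)
  desBitsQ : desBits Q ≡ desBits u'
  desBitsQ = desBits-ruArrange lq b (desBits u') (length-desBits u')

  φ≡W : φ m π ≡ W
  φ≡W = cong₂ (φ-build m c) takeπ dropπ

  P∈ : ∀ {x} → x ∈ P → Interval 1 m x
  P∈ {x} p = subst (λ k → Interval 1 k x) len (prefixInterval⊆ c a b x (to (hasP x) p))
  Q∈ : ∀ {x} → x ∈ Q → Interval 1 m x
  Q∈ {x} p = subst (λ k → Interval 1 k x) len (suffixInterval⊆ c a b x (to (hasQ x) p))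

  QP-elems : Q ++ P ≐ Interval 1 m
  QP-elems x = mk⇔ f g
    where
    f : x ∈ Q ++ P → Interval 1 m x
    f p with ∈-++⁻ Q p
    ... | inj₁ q = Q∈ q
    ... | inj₂ q = P∈ q
    g : Interval 1 m x → x ∈ Q ++ P
    g iv with prefix-suffix-cover c a b x (subst (λ k → Interval 1 k x) (sym len) iv)
    ... | inj₁ h = ∈-++⁺ʳ Q (from (hasP x) h)
    ... | inj₂ h = ∈-++⁺ˡ (from (hasQ x) h)

  QP-unique : Unique (Q ++ P)
  QP-unique = unique-++⁺ Q P uQ uP (λ {x} q p → prefix-suffix-disjoint c a b x (to (hasP x) p) (to (hasQ x) q))

  uniqW : Unique W
  uniqW = proj₁ (insertMax⁺ m P Q QP-unique QP-elems)

  hasW : W ≐ Interval 1 n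
  hasW = proj₂ (insertMax⁺ m P Q QP-unique QP-elems)

  permW : IsPerm n W
  permW = isPerm⁺ uniqW hasW

  takeW : take a W ≡ P
  takeW = take-split P Q n a lenP
  dropW : drop (suc a) W ≡ Q
  dropW = drop-split P Q n a lenP

  prefixSet⇔FirstSetᵇ : ∀ x → Interval lp a x ⇔ FirstSetᵇ c (suc a) n x
  prefixSet⇔FirstSetᵇ x = subst (λ k → Interval lp a x ⇔ FirstSetᵇ c (suc a) (suc k) x) len (prefixInterval⇔FirstSetᵇ c a b x)

  Des-prefixπ : filter (λ i → i ≤? suc a ∸ 2) (Des π) ≡ Des v
  Des-prefixπ = trans (cong (λ z → filter (λ i → i ≤? suc a ∸ 2) (Des z)) eq) (Des-prefix v n u' (suc a ∸ 2) refl)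

  Des-suffixπ : map (λ i → i ∸ suc a) (filter (λ i → suc a <? i) (Des π)) ≡ Des u'
  Des-suffixπ = trans (cong (λ z → map (λ i → i ∸ suc a) (filter (λ i → suc a <? i) (Des z))) eq) (Des-suffix v n u' (suc a) refl)

  W-isPhiAt : PhiAt n π W (suc a)
  W-isPhiAt = permW , at-split P Q n a lenP ,
    (λ x → subst (λ z → (x ∈ z) ⇔ FirstSetᵇ c (suc a) n x) (sym takeW)
       (mk⇔ (λ p → to (prefixSet⇔FirstSetᵇ x) (to (hasP x) p)) (λ q → from (hasP x) (from (prefixSet⇔FirstSetᵇ x) q)))) ,
    subst LeftUnimodal (sym takeW) (luArrange-leftUnimodal lp a (desBits v)) ,
    trans (cong Des takeW) (trans (trans (Des≡trues P) (trans (cong (trues 1) desBitsP) (sym (Des≡trues v)))) (sym Des-prefixπ)) ,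
    subst RightUnimodal (sym dropW) (ruArrange-rightUnimodal lq b (desBits u')) ,
    trans (cong Des dropW) (trans (trans (Des≡trues Q) (trans (cong (trues 1) desBitsQ) (sym (Des≡trues u')))) (sym Des-suffixπ))

  φ-isPhi : Phi n π (φ m π)
  φ-isPhi = subst₂ (λ w j → PhiAt n π w j) (sym φ≡W) (sym posπ) W-isPhiAt

  PhiAt-unique : ∀ w → PhiAt n π w (suc a) → w ≡ W
  PhiAt-unique w (pw , nw , fs , lP' , dP' , rQ' , dQ') = trans ew (cong₂ (λ p q → p ++ n ∷ q) eP eQ)
    where
    info = isPerm⁻ pw
    uw = proj₁ info
    hw = proj₁ (proj₂ info)
    lw = proj₂ (proj₂ info)
    a≤m : a ≤ m
    a≤m = subst (a ≤_) len (m≤m+n a b)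
    ew : w ≡ take a w ++ n ∷ drop (suc a) w
    ew = nth-split w (suc a) n (s≤s z≤n) (subst (suc a ≤_) (sym lw) (s≤s a≤m)) nw
    P' = take a w
    Q' = drop (suc a) w
    uw' : Unique (P' ++ n ∷ Q')
    uw' = subst Unique ew uw
    hP' : P' ≐ Interval lp a
    hP' x = mk⇔ (λ p → from (prefixSet⇔FirstSetᵇ x) (to (fs x) p)) (λ q → from (fs x) (to (prefixSet⇔FirstSetᵇ x) q))
    uP' : Unique P'
    uP' = UP.take⁺ a uw
    lenP' : length P' ≡ a
    lenP' = ≐interval⇒length uP' hP'
    fP' : desBits P' ≡ desBits v
    fP' = Des≡⇒desBits≡ P' v lenP' (trans dP' Des-prefixπ)
    eP : P' ≡ P
    eP = trans (luArrange-canonical P' lp a uP' hP' lP') (cong (luArrange lp a) fP')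
    QP′ = insertMax⁻ m P' Q' uw' (subst (_≐ Interval 1 n) ew hw)
    hQ' : Q' ≐ Interval lq b
    hQ' = suffix-elems c a b (proj₁ QP′) (subst (λ k → Q' ++ P' ≐ Interval 1 k) (sym len) (proj₂ QP′)) hP'
    uQ' : Unique Q'
    uQ' = UP.drop⁺ (suc a) uw
    lenQ' : length Q' ≡ b
    lenQ' = ≐interval⇒length uQ' hQ'
    fQ' : desBits Q' ≡ desBits u'
    fQ' = Des≡⇒desBits≡ Q' u' lenQ' (trans dQ' Des-suffixπ)
    eQ : Q' ≡ Q
    eQ = trans (ruArrange-canonical Q' lq b uQ' hQ' rQ') (cong (ruArrange lq b) fQ')

  Phi⇒≡φ : ∀ w → Phi n π w → w ≡ φ m π
  Phi⇒≡φ w ph = trans (PhiAt-unique w (subst (PhiAt n π w) posπ ph)) (sym φ≡W)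

splitCyclicBit-cong : ∀ P Q v u' → length P ≡ length v → length Q ≡ length u' →
  (0 < length v → 0 < length u' → splitCyclicBit P Q ≡ splitCyclicBit v u') → splitCyclicBit P Q ≡ splitCyclicBit v u'
splitCyclicBit-cong [] Q [] u' _ _ _ = refl
splitCyclicBit-cong (x ∷ P) [] (y ∷ v) [] _ _ _ = refl
splitCyclicBit-cong (x ∷ P) (z ∷ Q) (y ∷ v) (w ∷ u') _ _ h = h (s≤s z≤n) (s≤s z≤n)

splitCyclicBit-prefixStart : ∀ c a b P Q → P ≐ Interval (prefixStart c a b) a → Q ≐ Interval (suffixStart c a b) b → 0 < length P →
  0 < length Q → splitCyclicBit P Q ≡ c
splitCyclicBit-prefixStart c a b (x ∷ P) (y ∷ Q) hP hQ _ _ = h c hP hQ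
  where
  l∈ = lastOf∈ y Q
  h : ∀ c → x ∷ P ≐ Interval (prefixStart c a b) a → y ∷ Q ≐ Interval (suffixStart c a b) b → does (x <? lastOf y Q) ≡ c
  h true hP hQ = dec-true (x <? _) (<-≤-trans (proj₂ (to (hP x) (here refl))) (proj₁ (to (hQ _) l∈)))
  h false hP hQ = dec-false (x <? _) (λ lt → <-irrefl refl (<-trans (<-≤-trans (proj₂ (to (hQ _) l∈)) (proj₁ (to (hP x) (here refl)))) lt))

module Statistics {m : ℕ} {π : List ℕ} (ns : SplitAtMax m π) where
  open SplitAtMax ns
  open Construction ns

  P<n : All (_< n) P
  P<n = All.tabulate (λ {x} p → proj₂ (P∈ p))
  Q<n : All (_< n) Q
  Q<n = All.tabulate (λ {x} p → proj₂ (Q∈ p))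

  posW : posOf n W ≡ suc a
  posW = trans (posOf-++-∷ n P Q (λ p → <-irrefl refl (proj₂ (P∈ p)))) (cong suc lenP)

  lenW : length W ≡ n
  lenW = ≐interval⇒length uniqW hasW

  desBitsW : desBits W ≡ desBits π
  desBitsW = trans (desBits-around-max n P Q P<n Q<n)
    (trans (cong₂ _++_ (snocFalseIfNonEmpty-cong P v lenP desBitsP) (consIfNonEmpty-cong Q u' lenQ desBitsQ))
      (sym (trans (cong desBits eq) (desBits-around-max n v u' v<n u<n))))

  cyclicBitW : cyclicBit n W ≡ cyclicBit n π
  cyclicBitW = trans (cyclicBit-around-max m P Q P<n Q<n (trans (cong₂ _+_ lenP lenQ) len))
    (trans (splitCyclicBit-cong P Q v u' lenP lenQ
            (λ pa pb → trans (splitCyclicBit-prefixStart c a b P Q hasP hasQ (subst (0 <_) (sym lenP) pa) (subst (0 <_) (sym lenQ) pb)) cπ))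
      (sym cbπ))
    where
    cbπ : cyclicBit n π ≡ splitCyclicBit v u'
    cbπ = trans (cong (cyclicBit n) eq) (cyclicBit-around-max m v u' v<n u<n len)
    cπ : c ≡ splitCyclicBit v u'
    cπ = trans (n∈?cDes≡cyclicBit n π lenπ (s≤s z≤n)) cbπ

  cDesW : cDes n W ≡ cDes n π
  cDesW = trans (cDes≡trues n W lenW (s≤s z≤n))
      (trans (cong₂ (λ p q → trues 1 (p ++ [ q ])) desBitsW cyclicBitW) (sym (cDes≡trues n π lenπ (s≤s z≤n))))

-- Arc permutations

module _ (m : ℕ) where
  private
    n = suc m

  ∈-cycInt⁻ : ∀ {a k x} → x ∈ cycInt n a k → Σ ℕ (λ t → t < k × x ≡ suc ((a + t) % n))
  ∈-cycInt⁻ {a} {k} p with ∈-map⁻ (λ i → suc ((a + i) % n)) p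
  ... | t , q , e = t , ∈-upTo⁻ q , e

  ∈-cycInt⁺ : ∀ {a k t} → t < k → suc ((a + t) % n) ∈ cycInt n a k
  ∈-cycInt⁺ {a} {k} lt = ∈-map⁺ (λ i → suc ((a + i) % n)) (∈-upTo⁺ lt)

  cycInt-interval : ∀ c s → 1 ≤ c → c + s ≤ n → cycInt n (c ∸ 1) s ≐ Interval c s
  cycInt-interval (suc c') s _ cs x = mk⇔ f g
    where
    f : x ∈ cycInt n c' s → Interval (suc c') s x
    f p with ∈-cycInt⁻ {c'} {s} p
    ... | t , lt , refl = subst (λ z → Interval (suc c') s (suc z)) (sym md) (s≤s (m≤m+n c' t) , s≤s (+-monoʳ-< c' lt))
      where
      md : (c' + t) % n ≡ c' + t
      md = m<n⇒m%n≡m (<-≤-trans (+-monoʳ-< c' lt) (≤-pred (≤-trans cs (n≤1+n _))))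
    g : Interval (suc c') s x → x ∈ cycInt n c' s
    g (p , q) = subst (_∈ cycInt n c' s) ex (∈-cycInt⁺ {c'} {s} tlt)
      where
      t = x ∸ suc c'
      ex' : suc c' + t ≡ x
      ex' = m+[n∸m]≡n p
      tlt : t < s
      tlt = +-cancelˡ-< (suc c') t s (subst (_< suc c' + s) (sym ex') q)
      ex : suc ((c' + t) % n) ≡ x
      ex = trans (cong suc (m<n⇒m%n≡m (<-≤-trans (+-monoʳ-< c' tlt) (≤-trans (≤-pred cs) (n≤1+n m))))) ex'

  module _ (c' s : ℕ) (cs : suc c' + s ≤ n) where
    private
      A = c' + s
      A≤m : A ≤ m
      A≤m = ≤-pred cs
      s≤n : s ≤ n
      s≤n = ≤-trans (m≤n+m s c') (≤-trans A≤m (n≤1+n m))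

    cycInt-complement⁻ : ∀ {x} → x ∈ cycInt n A (n ∸ s) → Interval 1 n x × ¬ Interval (suc c') s x
    cycInt-complement⁻ p with ∈-cycInt⁻ {A} {n ∸ s} p
    ... | t , lt , refl = (s≤s z≤n , s≤s (m%n<n (A + t) n)) , notin
      where
      notin : ¬ Interval (suc c') s (suc ((A + t) % n))
      notin (r1 , r2) with A + t <? n
      ... | yes small = <-irrefl refl (<-≤-trans (≤-pred r2) (subst (A ≤_) (sym (m<n⇒m%n≡m small)) (m≤m+n A t)))
      ... | no big = <-irrefl refl (≤-<-trans (≤-pred r1) (subst (_< c') (sym md) r'<c'))
        where
        r' = (A + t) ∸ n
        er : r' + n ≡ A + t
        er = m∸n+n≡m (≮⇒≥ big)
        A<n : A < n
        A<n = s≤s A≤m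
        r'<n : r' < n
        r'<n = +-cancelʳ-< n r' n (subst (_< n + n) (sym er) (+-mono-< A<n (<-≤-trans lt (m∸n≤m n s))))
        md : (A + t) % n ≡ r'
        md = trans (cong (_% n) (sym er)) (trans ([m+n]%n≡m%n r' n) (m<n⇒m%n≡m r'<n))
        -- r' + n = c' + s + t < c' + s + (n - s) = c' + n
        r'<c' : r' < c'
        r'<c' = +-cancelʳ-< n r' c' (subst (_< c' + n) (sym er)
                  (subst (A + t <_) e2 (+-monoʳ-< A lt)))
          where
          e2 : A + (n ∸ s) ≡ c' + n
          e2 = trans (+-assoc c' s (n ∸ s)) (cong (c' +_) (m+[n∸m]≡n s≤n))

    cycInt-complement⁺ : ∀ {x} → Interval 1 n x × ¬ Interval (suc c') s x → x ∈ cycInt n A (n ∸ s)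
    cycInt-complement⁺ {x} ((p , q) , nin) with x <? suc c'
    ... | yes below = subst (_∈ cycInt n A (n ∸ s)) ex (∈-cycInt⁺ {A} {n ∸ s} tlt)
      where
      x' = x ∸ 1
      ex' : suc x' ≡ x
      ex' = m+[n∸m]≡n p
      x'<c' : x' < c'
      x'<c' = subst (_≤ c') (sym ex') (≤-pred below)
      t = (n ∸ A) + x'
      eA : A + t ≡ x' + n
      eA = trans (sym (+-assoc A (n ∸ A) x')) (trans (cong (_+ x') (m+[n∸m]≡n (≤-trans A≤m (n≤1+n m)))) (+-comm n x'))
      tlt : t < n ∸ s
      tlt = +-cancelʳ-< s t (n ∸ s) (subst₂ _<_ (sym e3) (trans (m∸n+n≡m (≤-trans A≤m (n≤1+n m))) (sym (m∸n+n≡m s≤n)))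
            (+-monoʳ-< (n ∸ A) (+-monoˡ-< s x'<c')))
        where
        e3 : t + s ≡ (n ∸ A) + (x' + s)
        e3 = trans (+-assoc (n ∸ A) x' s) refl
      ex : suc ((A + t) % n) ≡ x
      ex = trans (cong suc (trans (cong (_% n) eA)
              (trans ([m+n]%n≡m%n x' n) (m<n⇒m%n≡m (<-trans x'<c' (s≤s (≤-trans (m≤m+n c' s) A≤m))))))) ex'
    ... | no notbelow = subst (_∈ cycInt n A (n ∸ s)) ex (∈-cycInt⁺ {A} {n ∸ s} tlt)
      where
      x' = x ∸ 1
      ex' : suc x' ≡ x
      ex' = m+[n∸m]≡n p
      ge : A ≤ x'
      ge with x <? suc c' + s
      ... | yes lt' = ⊥-elim (nin (≮⇒≥ notbelow , lt'))
      ... | no ge' = ≤-pred (subst (suc c' + s ≤_) (sym ex') (≮⇒≥ ge'))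
      t = x' ∸ A
      x'<n : x' < n
      x'<n = subst (_≤ n) (sym ex') (≤-pred q)
      eA : A + t ≡ x'
      eA = m+[n∸m]≡n ge
      tlt : t < n ∸ s
      tlt = +-cancelˡ-< A t (n ∸ s) (subst₂ _<_ (sym eA) e2 (<-≤-trans x'<n (m≤n+m n c')))
        where
        e2 : c' + n ≡ A + (n ∸ s)
        e2 = sym (trans (+-assoc c' s (n ∸ s)) (cong (c' +_) (m+[n∸m]≡n s≤n)))
      ex : suc ((A + t) % n) ≡ x
      ex = trans (cong suc (trans (cong (_% n) eA) (m<n⇒m%n≡m x'<n))) ex'

  cycInt-complement : ∀ c s → 1 ≤ c → c + s ≤ n → cycInt n (c + s ∸ 1) (n ∸ s) ≐ (λ x → Interval 1 n x × ¬ Interval c s x)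
  cycInt-complement (suc c') s _ cs x = mk⇔ (cycInt-complement⁻ c' s cs) (cycInt-complement⁺ c' s cs)

  [m+n]%o≡[m%o+n]%o : ∀ a t → (a + t) % n ≡ (a % n + t) % n
  [m+n]%o≡[m%o+n]%o a t = trans (cong (_% n) (+-comm a t)) (trans ([m+n]%o≡[m+n%o]%o t a n) (cong (_% n) (+-comm t (a % n))))

  cycInt-% : ∀ a k x → x ∈ cycInt n a k ⇔ x ∈ cycInt n (a % n) k
  cycInt-% a k x = mk⇔ f g
    where
    f : x ∈ cycInt n a k → x ∈ cycInt n (a % n) k
    f p with ∈-cycInt⁻ {a} {k} p
    ... | t , lt , refl = subst (_∈ cycInt n (a % n) k) (cong suc (sym ([m+n]%o≡[m%o+n]%o a t))) (∈-cycInt⁺ {a % n} {k} lt)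
    g : x ∈ cycInt n (a % n) k → x ∈ cycInt n a k
    g p with ∈-cycInt⁻ {a % n} {k} p
    ... | t , lt , refl = subst (_∈ cycInt n a k) (cong suc ([m+n]%o≡[m%o+n]%o a t)) (∈-cycInt⁺ {a} {k} lt)

  ≐-resp : ∀ {xs ys : List ℕ} {P : ℕ → Set} → (∀ x → x ∈ xs ⇔ x ∈ ys) → ys ≐ P → xs ≐ P
  ≐-resp e h x = mk⇔ (λ p → to (h x) (to (e x) p)) (λ q → from (e x) (from (h x) q))

  CointervalIn : List ℕ → Set
  CointervalIn xs = Σ ℕ λ c → Σ ℕ λ s → 1 ≤ c × c + s ≤ n × xs ≐ (λ x → Interval 1 n x × ¬ Interval c s x)

  -- A cyclic interval either avoids n, and is then an interval of [n - 1], or contains n, and is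
  -- then the complement of one.
  cycInt-classify : ∀ a k → IntervalIn 1 n (cycInt n a k) ⊎ CointervalIn (cycInt n a k)
  cycInt-classify a k with (a % n) + k <? n
  ... | yes small = inj₁ (suc a' , k , s≤s z≤n , small , ≐-resp (cycInt-% a k) (cycInt-interval (suc a') k (s≤s z≤n) small))
    where a' = a % n
  ... | no big with k ≤? n
  ...   | yes k≤n = inj₂ (suc d , n ∸ k , s≤s z≤n , cs , ≐-resp (cycInt-% a k)
        (subst₂ (λ p q → cycInt n p q ≐ (λ x → Interval 1 n x × ¬ Interval (suc d) (n ∸ k) x)) e (m∸[m∸n]≡n k≤n)
              (cycInt-complement (suc d) (n ∸ k) (s≤s z≤n) cs)))
    where
    a' = a % n
    d = a' + k ∸ n
    ed : d + n ≡ a' + k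
    ed = m∸n+n≡m (≮⇒≥ big)
    e : d + (n ∸ k) ≡ a'
    e = +-cancelʳ-≡ k (d + (n ∸ k)) a' (trans (+-assoc d (n ∸ k) k) (trans (cong (d +_) (m∸n+n≡m k≤n)) ed))
    cs : suc d + (n ∸ k) ≤ n
    cs = subst (_≤ n) (cong suc (sym e)) (m%n<n a n)
  ...   | no k>n = inj₂ (1 , 0 , ≤-refl , s≤s z≤n , ≐-resp (cycInt-% a k) h)
    where
    a' = a % n
    h : cycInt n a' k ≐ (λ x → Interval 1 n x × ¬ Interval 1 0 x)
    h x = mk⇔ f g
      where
      f : x ∈ cycInt n a' k → Interval 1 n x × ¬ Interval 1 0 x
      f p with ∈-cycInt⁻ {a'} {k} p
      ... | t , lt , refl = (s≤s z≤n , s≤s (m%n<n (a' + t) n)) , λ { (_ , s≤s ()) }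
      g : Interval 1 n x × ¬ Interval 1 0 x → x ∈ cycInt n a' k
      g (iv , _) with ∈-cycInt⁻ {a' + 0} {n} (from
            (cycInt-complement (suc a') 0 (s≤s z≤n) (subst (_≤ n) (cong suc (sym (+-identityʳ a'))) (m%n<n a n)) x)
                (iv , λ { (p , q) → <-irrefl refl (<-≤-trans q (subst (_≤ x) (sym (+-identityʳ (suc a'))) p)) }))
      ... | t , lt , refl = subst (λ z → suc ((z + t) % n) ∈ cycInt n a' k) (sym (+-identityʳ a'))
          (∈-cycInt⁺ {a'} {k} (<-trans lt (≰⇒> k>n)))

  ∈-take⇔∉-drop : ∀ W → Unique W → W ≐ Interval 1 n → ∀ t x → x ∈ take t W ⇔ (Interval 1 n x × x ∉ drop t W)
  ∈-take⇔∉-drop W uW hW t x = mk⇔ f g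
    where
    uW' : Unique (take t W ++ drop t W)
    uW' = subst Unique (sym (take++drop≡id t W)) uW
    f : x ∈ take t W → Interval 1 n x × x ∉ drop t W
    f p = to (hW x) (subst (x ∈_) (take++drop≡id t W) (∈-++⁺ˡ p)) , unique-++-disjoint (take t W) (drop t W) uW' p
    g : Interval 1 n x × x ∉ drop t W → x ∈ take t W
    g (iv , nd) with ∈-++⁻ (take t W) (subst (x ∈_) (sym (take++drop≡id t W)) (from (hW x) iv))
    ... | inj₁ p = p
    ... | inj₂ q = ⊥-elim (nd q)

  PrefixOrSuffixInterval : List ℕ → ℕ → Set
  PrefixOrSuffixInterval W t = IntervalIn 1 n (take t W) ⊎ IntervalIn 1 n (drop t W)

  InA⁺ : ∀ W → Unique W → W ≐ Interval 1 n → (∀ t → PrefixOrSuffixInterval W t) → InA n W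
  InA⁺ W uW hW h = isPerm⁺ uW hW , λ t → go t (h t)
    where
    go : ∀ t → PrefixOrSuffixInterval W t → ∃[ a ] ∃[ k ] (∀ x → (x ∈ take t W) ⇔ (x ∈ cycInt n a k))
    go t (inj₁ (c , s , c1 , cs , ht)) = c ∸ 1 , s , λ x → mk⇔ (λ p → from (cycInt-interval c s c1 cs x) (to (ht x) p))
        (λ q → from (ht x) (to (cycInt-interval c s c1 cs x) q))
    go t (inj₂ (c , s , c1 , cs , hd)) = c + s ∸ 1 , n ∸ s , λ x → mk⇔
      (λ p → from (cycInt-complement c s c1 cs x)
            (proj₁ (to (∈-take⇔∉-drop W uW hW t x) p) , λ iv → proj₂ (to (∈-take⇔∉-drop W uW hW t x) p) (from (hd x) iv)))
      (λ q → from (∈-take⇔∉-drop W uW hW t x) (proj₁ (to (cycInt-complement c s c1 cs x) q) , λ d → proj₂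
              (to (cycInt-complement c s c1 cs x) q) (to (hd x) d)))

  Interval? : ∀ c s x → Dec (Interval c s x)
  Interval? c s x with c ≤? x | x <? c + s
  ... | yes p | yes q = yes (p , q)
  ... | no p | _ = no (λ z → p (proj₁ z))
  ... | yes _ | no q = no (λ z → q (proj₂ z))

  InA⁻ : ∀ W → InA n W → ∀ t →
    (n ∉ take t W → IntervalIn 1 n (take t W)) × (n ∈ take t W → IntervalIn 1 n (drop t W))
  InA⁻ W (pW , f) t with f t
  ... | a , k , e with cycInt-classify a k
  ...   | inj₁ (c , s , c1 , cs , h) = (λ _ → c , s , c1 , cs , ≐-resp e h) ,
          (λ p → ⊥-elim (<-irrefl refl (<-≤-trans (proj₂ (to (h n) (to (e n) p))) cs)))
  ...   | inj₂ (c , s , c1 , cs , h) =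
          (λ np → ⊥-elim (np (from (e n) (from (h n) ((s≤s z≤n , ≤-refl) , λ iv → <-irrefl refl (<-≤-trans (proj₂ iv) cs)))))) ,
          (λ _ → c , s , c1 , cs , hd)
    where
    info = isPerm⁻ pW
    uW = proj₁ info
    hW = proj₁ (proj₂ info)
    ht : take t W ≐ (λ x → Interval 1 n x × ¬ Interval c s x)
    ht = ≐-resp e h
    ivn : ∀ {x} → Interval c s x → Interval 1 n x
    ivn (p , q) = ≤-trans c1 p , <-≤-trans q (≤-trans cs (n≤1+n n))
    hd : drop t W ≐ Interval c s
    hd x = mk⇔ g1 g2
      where
      g1 : x ∈ drop t W → Interval c s x
      g1 p with Interval? c s x
      ... | yes iv = iv
      ... | no niv = ⊥-elim (proj₂ (to (∈-take⇔∉-drop W uW hW t x)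
              (from (ht x) (to (hW x) (subst (x ∈_) (take++drop≡id t W) (∈-++⁺ʳ (take t W) p)) , niv))) p)
      g2 : Interval c s x → x ∈ drop t W
      g2 iv with ∈-++⁻ (take t W) (subst (x ∈_) (sym (take++drop≡id t W)) (from (hW x) (ivn iv)))
      ... | inj₁ p = ⊥-elim (proj₂ (to (ht x) p) iv)
      ... | inj₂ q = q

module ArcImage {m : ℕ} {π : List ℕ} (ns : SplitAtMax m π) where
  open SplitAtMax ns
  open Construction ns
  open Statistics ns

  φ-arc : InA n W
  φ-arc = InA⁺ m W uniqW hasW h
    where
    h : ∀ t → PrefixOrSuffixInterval m W t
    h t with t ≤? a
    ... | yes le with luArrange-prefix lp a (desBits v) (length-desBits v) t
    ...   | c' , s' , lo≤ , cs≤ , hh = inj₁ (c' , s' , ≤-trans (prefixStart≥1 c a b) lo≤ ,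
            ≤-trans cs≤ (subst (λ k → lp + a ≤ suc k) len (prefixInterval-bound c a b)) ,
            subst (_≐ Interval c' s') (sym (take-++≤ P (n ∷ Q) t (subst (t ≤_) (sym lenP) le))) hh)
    h t | no gt with ruArrange-suffix lq b (desBits u') (length-desBits u') (t ∸ suc a)
    ...   | c' , s' , lo≤ , cs≤ , hh = inj₂ (c' , s' , ≤-trans (suffixStart≥1 c a b) lo≤ ,
            ≤-trans cs≤ (subst (λ k → lq + b ≤ suc k) len (suffixInterval-bound c a b)) ,
            subst (_≐ Interval c' s') (sym ed) hh)
      where
      et : t ≡ suc (length P) + (t ∸ suc a)
      et = trans (sym (m+[n∸m]≡n (≰⇒> gt))) (cong (λ k → suc k + (t ∸ suc a)) (sym lenP))
      ed : drop t W ≡ drop (t ∸ suc a) Q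
      ed = trans (cong (λ k → drop k W) et) (drop-after P Q n (t ∸ suc a))

-- Bijectivity

-- The descents of u′v are those of u′ and of v plus the one at the junction, which is the
-- cyclic descent of v n u′ at n.
SplitAtMax-cDes-injective : ∀ {m π π′} (ns : SplitAtMax m π) (ns′ : SplitAtMax m π′) →
  let open SplitAtMax ns; open SplitAtMax ns′ renaming (v to v′; u' to u″) in
  length v ≡ length v′ → length u' ≡ length u″ → cDes (suc m) π ≡ cDes (suc m) π′ →
  desBits (u' ++ v) ≡ desBits (u″ ++ v′)
SplitAtMax-cDes-injective {m} {π} {π′} ns ns′ la lb eD =
  desBits-++-cong u' u″ v v′ lb la (consIfNonEmpty-injective u' u″ lb (proj₂ halves))
    (snocFalseIfNonEmpty-injective v v′ la (proj₁ halves)) splitBits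
  where
  open SplitAtMax ns
  open SplitAtMax ns′ renaming (v to v′; u' to u″; eq to eq′)
  module F = SplitFacts ns
  module F′ = SplitFacts ns′
  n = suc m
  bits = cDes≡⇒desBits≡ n π π′ F.lenπ F′.lenπ (s≤s z≤n) eD
  around : ∀ {π v u} → π ≡ v ++ n ∷ u → All (_< n) v → All (_< n) u →
    desBits π ≡ snocFalseIfNonEmpty v (desBits v) ++ consIfNonEmpty true u (desBits u)
  around {v = v} {u} refl v<n u<n = desBits-around-max n v u v<n u<n
  halves = ++-injective _ _ _ _ (trans (length-snocFalseIfNonEmpty v) (trans la (sym (length-snocFalseIfNonEmpty v′))))
             (trans (sym (around eq F.v<n F.u<n)) (trans (proj₁ bits) (around eq′ F′.v<n F′.u<n)))
  splitBits : splitCyclicBit v u' ≡ splitCyclicBit v′ u″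
  splitBits = trans (sym (trans (cong (cyclicBit n) eq) (cyclicBit-around-max m v u' F.v<n F.u<n F.len)))
                (trans (proj₂ bits) (trans (cong (cyclicBit n) eq′) (cyclicBit-around-max m v′ u″ F′.v<n F′.u<n F′.len)))

RotatedLU-stats-injective : ∀ m π π′ → RotatedLU m π → RotatedLU m π′ →
  posOf (suc m) π ≡ posOf (suc m) π′ → cDes (suc m) π ≡ cDes (suc m) π′ → π ≡ π′
RotatedLU-stats-injective m π π′ d d′ ep eD =
  trans (RotatedLU.eq d) (trans (cong₂ (λ r u → drop r u ++ suc m ∷ take r u) r≡ u≡) (sym (RotatedLU.eq d′)))
  where
  open RotatedLU d
  open RotatedLU d′ renaming (u to u′; r to r′; uu to uu′; uh to uh′; ul to ul′; r≤ to r≤′)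
  ns = RotatedLU⇒SplitAtMax m π d
  ns′ = RotatedLU⇒SplitAtMax m π′ d′
  la : length (drop r u) ≡ length (drop r′ u′)
  la = suc-injective (trans (sym (SplitFacts.posπ ns)) (trans ep (SplitFacts.posπ ns′)))
  length-drop≡ : ∀ {r u} → u ≐ Interval 1 m → Unique u → length (drop r u) ≡ m ∸ r
  length-drop≡ {r} {u} h un = trans (length-drop r u) (cong (_∸ r) (≐interval⇒length un h))
  r≡ : r ≡ r′
  r≡ = trans (sym (m∸[m∸n]≡n r≤))
         (trans (cong (m ∸_) (trans (sym (length-drop≡ {r} uh uu)) (trans la (length-drop≡ {r′} uh′ uu′))))
           (m∸[m∸n]≡n r≤′))
  lb : length (take r u) ≡ length (take r′ u′)
  lb = +-cancelˡ-≡ (length (drop r u)) _ _ (trans (SplitFacts.len ns) (sym (trans (cong (_+ length (take r′ u′)) la) (SplitFacts.len ns′))))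
  u≡ : u ≡ u′
  u≡ = trans (luArrange-canonical u 1 m uu uh ul)
         (trans (cong (luArrange 1 m) (subst₂ (λ p q → desBits p ≡ desBits q) (take++drop≡id r u) (take++drop≡id r′ u′)
                                         (SplitAtMax-cDes-injective ns ns′ la lb eD)))
           (sym (luArrange-canonical u′ 1 m uu′ uh′ ul′)))

-- The blocks of an arc permutation A n B are complementary intervals of [m]; the one containing 1
-- is the lower one, and comparing the first entry of A with the last of B tells which it is.
arc-prefix-elems : ∀ m A B cA cB → Unique (B ++ A) → B ++ A ≐ Interval 1 m → length A + length B ≡ m →
  1 ≤ cA → cA + length A ≤ suc m → A ≐ Interval cA (length A) →
  1 ≤ cB → B ≐ Interval cB (length B) →
  A ≐ Interval (prefixStart (splitCyclicBit A B) (length A) (length B)) (length A)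
arc-prefix-elems m [] B cA cB uBA hBA l c1 cs hA d1 hB = []-elems _
arc-prefix-elems m (x ∷ A) [] cA cB uBA hBA l c1 cs hA d1 hB = subst (λ k → x ∷ A ≐ Interval k (length (x ∷ A))) cA≡1 hA
  where
  cA≡1 : cA ≡ 1
  cA≡1 = ≤-antisym (+-cancelʳ-≤ (length (x ∷ A)) cA 1
        (subst (cA + length (x ∷ A) ≤_) (cong suc (sym (trans (sym (+-identityʳ _)) l))) cs)) c1
arc-prefix-elems m (x ∷ A) (y ∷ B) cA cB uBA hBA l c1 cs hA d1 hB with ∈-++⁻ (y ∷ B)
    (from (hBA 1) (≤-refl , s≤s (subst (0 <_) l (s≤s z≤n))))
... | inj₂ p1 = subst₂ (λ c k → x ∷ A ≐ Interval (prefixStart c k (length (y ∷ B))) k) (sym cbt) refl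
    (subst (λ k → x ∷ A ≐ Interval k a) cA≡1 hA)
  where
  a = length (x ∷ A)
  cA≡1 : cA ≡ 1
  cA≡1 = ≤-antisym (proj₁ (to (hA 1) p1)) c1
  L = lastOf y B
  L∈B : L ∈ y ∷ B
  L∈B = lastOf∈ y B
  a<L : a < L
  a<L with L ≤? a
  ... | no gt = ≰⇒> gt
  ... | yes le = ⊥-elim (unique-++-disjoint (y ∷ B) (x ∷ A) uBA L∈B
        (from (hA L) (subst (_≤ L) (sym cA≡1) (proj₁ (to (hBA L) (∈-++⁺ˡ L∈B))) , subst (λ k → L < k + a) (sym cA≡1) (s≤s le))))
  cbt : splitCyclicBit (x ∷ A) (y ∷ B) ≡ true
  cbt = dec-true (x <? L) (≤-<-trans (≤-pred (subst (λ k → x < k + a) cA≡1 (proj₂ (to (hA x) (here refl))))) a<L)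
... | inj₁ p1 = subst₂ (λ c k → x ∷ A ≐ Interval (prefixStart c a b) k) (sym cbf) refl (subst (λ k → x ∷ A ≐ Interval k a) cA≡ hA)
  where
  a = length (x ∷ A)
  b = length (y ∷ B)
  cB≡1 : cB ≡ 1
  cB≡1 = ≤-antisym (proj₁ (to (hB 1) p1)) d1
  cA∈A : cA ∈ x ∷ A
  cA∈A = from (hA cA) (≤-refl , m<m+n cA (s≤s z≤n))
  b<cA : b < cA
  b<cA with cA ≤? b
  ... | no gt = ≰⇒> gt
  ... | yes le = ⊥-elim (unique-++-disjoint (y ∷ B) (x ∷ A) uBA
        (from (hB cA) (subst (_≤ cA) (sym cB≡1) c1 , subst (λ k → cA < k + b) (sym cB≡1) (s≤s le))) cA∈A)
  cA≤ : cA ≤ suc b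
  cA≤ = +-cancelʳ-≤ a cA (suc b) (subst (cA + a ≤_) (cong suc (trans (sym l) (+-comm a b))) cs)
  cA≡ : cA ≡ suc b
  cA≡ = ≤-antisym cA≤ b<cA
  L = lastOf y B
  cbf : splitCyclicBit (x ∷ A) (y ∷ B) ≡ false
  cbf = dec-false (x <? L) (λ lt → <-irrefl refl
        (<-trans lt (<-≤-trans (subst (λ k → L < k + b) cB≡1 (proj₂ (to (hB L) (lastOf∈ y B))))
                (subst (_≤ x) cA≡ (proj₁ (to (hA x) (here refl)))))))

module Preimage (m : ℕ) (A B : List ℕ) (arc : InA (suc m) (A ++ suc m ∷ B)) where
  n = suc m
  w = A ++ n ∷ B
  perm = proj₁ arc
  uniq-w = proj₁ (isPerm⁻ perm)
  ns = isPerm⇒SplitAtMax m A B perm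
  module F = SplitFacts ns
  a = length A
  b = length B
  arcIntervals = InA⁻ m w arc
  uA : Unique A
  uA = unique-++⁻ˡ A (n ∷ B) uniq-w
  uB : Unique B
  uB = UP.drop⁺ 1 (unique-++⁻ʳ A (n ∷ B) uniq-w)

  takeA : ∀ k → k ≤ a → take k w ≡ take k A
  takeA k le = take-++≤ A (n ∷ B) k le

  luA : LeftUnimodal A
  luA = ExtremalHeads-reverse⇒LeftUnimodal A (suffixIntervals⇒ExtremalHeads (reverse A) (Unique-reverse A uA) h)
    where
    h : ∀ t → IsInterval (drop t (reverse A))
    h t with drop-reverse A t
    ... | k , k≤ , e with proj₁ (arcIntervals k) (λ p → F.n∉v (∈-take k A (subst (n ∈_) (takeA k k≤) p)))
    ...   | c , s , _ , _ , hh = c , s , subst (_≐ Interval c s) (sym e)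
        (≐-reverse (take k A) (subst (_≐ Interval c s) (takeA k k≤) hh))

  ruB : RightUnimodal B
  ruB = ExtremalHeads⇒RightUnimodal B (suffixIntervals⇒ExtremalHeads B uB h)
    where
    h : ∀ t → IsInterval (drop t B)
    h t with proj₂ (arcIntervals (suc a + t)) (subst (n ∈_) (sym (take-after A B n t)) (∈-++⁺ʳ A (here refl)))
    ... | c , s , _ , _ , hh = c , s , subst (_≐ Interval c s) (drop-after A B n t) hh

  A-elems : A ≐ Interval (prefixStart (splitCyclicBit A B) a b) a
  A-elems with proj₁ (arcIntervals a) (λ p → F.n∉v (subst (n ∈_) (take-length-++ A (n ∷ B)) p))
  ... | cA , sA , c1 , cs , hA0 with proj₂ (arcIntervals (suc a))
      (subst (n ∈_) (sym (trans (cong (λ k → take k w) (sym (+-identityʳ (suc a)))) (take-after A B n 0))) (∈-++⁺ʳ A (here refl)))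
  ...   | cB , sB , d1 , _ , hB0 = arc-prefix-elems m A B cA cB (SplitAtMax.uu ns) (SplitAtMax.hu ns) F.len c1
      (subst (λ k → cA + k ≤ n) sA≡ cs) (subst (λ k → A ≐ Interval cA k) sA≡ hA) d1 (subst (λ k → B ≐ Interval cB k) sB≡ hB)
    where
    hA : A ≐ Interval cA sA
    hA = subst (_≐ Interval cA sA) (take-length-++ A (n ∷ B)) hA0
    sA≡ : sA ≡ a
    sA≡ = sym (≐interval⇒length uA hA)
    hB : B ≐ Interval cB sB
    hB = subst (_≐ Interval cB sB) (drop-split A B n a refl) hB0
    sB≡ : sB ≡ b
    sB≡ = sym (≐interval⇒length uB hB)

  bits = desBits (B ++ A)
  lbs : length bits ≡ m ∸ 1
  lbs = trans (length-desBits (B ++ A)) (cong (_∸ 1) (≐interval⇒length (SplitAtMax.uu ns) (SplitAtMax.hu ns)))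
  u = luArrange 1 m bits
  b≤m : b ≤ m
  b≤m = subst (b ≤_) F.len (m≤n+m b a)
  π = drop b u ++ n ∷ take b u
  d : RotatedLU m π
  d = record { u = u ; r = b ; uu = luArrange-unique 1 m bits ; uh = luArrange-elems 1 m bits lbs ; ul = luArrange-leftUnimodal 1 m bits ; r≤ = b≤m ; eq = refl }
  inLC : InLC n π
  inLC = RotatedLU⇒InLC m u b (luArrange-unique 1 m bits) (luArrange-elems 1 m bits lbs) (luArrange-leftUnimodal 1 m bits) b≤m
  ns' = RotatedLU⇒SplitAtMax m π d
  module G = SplitFacts ns'
  v = drop b u
  u' = take b u
  lenu : length u ≡ m
  lenu = length-luArrange 1 m bits lbs
  lu' : length u' ≡ b
  lu' = trans (length-take b u) (trans (cong (b ⊓_) lenu) (m≤n⇒m⊓n≡m b≤m))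
  lv : length v ≡ a
  lv = trans (length-drop b u) (trans (cong (_∸ b) lenu) (trans (cong (_∸ b) (sym F.len)) (m+n∸n≡m a b)))
  junction = desBits-++⁻ u' B v A lu' lv (trans (cong desBits (take++drop≡id b u)) (desBits-luArrange 1 m bits lbs))
  desBitsπ : desBits π ≡ desBits w
  desBitsπ = trans (desBits-around-max n v u' G.v<n G.u<n)
    (trans (cong₂ _++_ (snocFalseIfNonEmpty-cong v A lv (proj₁ (proj₂ junction))) (consIfNonEmpty-cong u' B lu' (proj₁ junction)))
      (sym (desBits-around-max n A B F.v<n F.u<n)))
  cyclicBit-w : cyclicBit n w ≡ splitCyclicBit A B
  cyclicBit-w = cyclicBit-around-max m A B F.v<n F.u<n F.len
  cyclicBitπ : cyclicBit n π ≡ cyclicBit n w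
  cyclicBitπ = trans (cyclicBit-around-max m v u' G.v<n G.u<n G.len) (trans (proj₂ (proj₂ junction)) (sym cyclicBit-w))

  posπ : posOf n π ≡ suc a
  posπ = trans G.posπ (cong suc lv)
  Desπ : Des π ≡ Des w
  Desπ = trans (Des≡trues π) (trans (cong (trues 1) desBitsπ) (sym (Des≡trues w)))
  cπ : does (n ∈? cDes n π) ≡ splitCyclicBit A B
  cπ = trans (n∈?cDes≡cyclicBit n π G.lenπ (s≤s z≤n)) (trans cyclicBitπ cyclicBit-w)

  w-isPhiAt : PhiAt n π w (suc a)
  w-isPhiAt = perm , at-split A B n a refl ,
    (λ x → subst (λ z → (x ∈ z) ⇔ FirstSetᵇ (does (n ∈? cDes n π)) (suc a) n x) (sym (take-split A B n a refl))
       (subst (λ c → x ∈ A ⇔ FirstSetᵇ c (suc a) n x) (sym cπ)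
         (subst (λ k → x ∈ A ⇔ FirstSetᵇ (splitCyclicBit A B) (suc a) (suc k) x) F.len
           (mk⇔ (λ p → to (prefixInterval⇔FirstSetᵇ (splitCyclicBit A B) a b x) (to (A-elems x) p))
                 (λ q → from (A-elems x) (from (prefixInterval⇔FirstSetᵇ (splitCyclicBit A B) a b x) q)))))) ,
    subst LeftUnimodal (sym (take-split A B n a refl)) luA ,
    trans (cong Des (take-split A B n a refl))
        (sym (trans (cong (filter (λ i → i ≤? suc a ∸ 2)) Desπ) (Des-prefix A n B (suc a ∸ 2) refl))) ,
    subst RightUnimodal (sym (drop-split A B n a refl)) ruB ,
    trans (cong Des (drop-split A B n a refl))
        (sym (trans (cong (λ z → map (λ i → i ∸ suc a) (filter (λ i → suc a <? i) z)) Desπ) (Des-suffix A n B (suc a) refl)))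

  phi : Phi n π w
  phi = subst (PhiAt n π w) (sym posπ) w-isPhiAt

φ-surjective : ∀ m w → InA (suc m) w → ∃[ π ] (InLC (suc m) π × Phi (suc m) π w)
φ-surjective m w arc with ∈-∃++ (from (proj₁ (proj₂ (isPerm⁻ (proj₁ arc))) (suc m)) (s≤s z≤n , ≤-refl))
... | A , B , refl = Preimage.π m A B arc , Preimage.inLC m A B arc , Preimage.phi m A B arc

-- Enumeration

allBitLists : ℕ → List (List Bool)
allBitLists zero = [ [] ]
allBitLists (suc k) = map (true ∷_) (allBitLists k) ++ map (false ∷_) (allBitLists k)

allBitLists-unique : ∀ k → Unique (allBitLists k)
allBitLists-unique zero = [] ∷ []
allBitLists-unique (suc k) = UP.++⁺ (UP.map⁺ ∷-injectiveʳ (allBitLists-unique k)) (UP.map⁺ ∷-injectiveʳ (allBitLists-unique k)) d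
  where
  d : ∀ {v} → ¬ (v ∈ map (true ∷_) (allBitLists k) × v ∈ map (false ∷_) (allBitLists k))
  d (p , q) with ∈-map⁻ (true ∷_) p | ∈-map⁻ (false ∷_) q
  ... | _ , _ , refl | _ , _ , ()

allBitLists-complete : ∀ bs → bs ∈ allBitLists (length bs)
allBitLists-complete [] = here refl
allBitLists-complete (true ∷ bs) = ∈-++⁺ˡ (∈-map⁺ (true ∷_) (allBitLists-complete bs))
allBitLists-complete (false ∷ bs) = ∈-++⁺ʳ (map (true ∷_) (allBitLists (length bs))) (∈-map⁺ (false ∷_) (allBitLists-complete bs))

length-∈-allBitLists : ∀ k {bs} → bs ∈ allBitLists k → length bs ≡ k
length-∈-allBitLists zero (here refl) = refl
length-∈-allBitLists (suc k) p with ∈-++⁻ (map (true ∷_) (allBitLists k)) p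
... | inj₁ q with ∈-map⁻ (true ∷_) q
...   | _ , r , refl = cong suc (length-∈-allBitLists k r)
length-∈-allBitLists (suc k) p | inj₂ q with ∈-map⁻ (false ∷_) q
...   | _ , r , refl = cong suc (length-∈-allBitLists k r)

module _ (m : ℕ) where
  private
    n = suc m

  -- σcₙᵏ is determined by the descents of σ ∈ 𝓛_{n-1} and by k mod n.
  lcData : List (List Bool × ℕ)
  lcData = cartesianProduct (allBitLists (m ∸ 1)) (upTo (suc m))

  rotatedLU : List Bool × ℕ → List ℕ
  rotatedLU (bs , r) = drop r (luArrange 1 m bs) ++ n ∷ take r (luArrange 1 m bs)

  lcList : List (List ℕ)
  lcList = map rotatedLU lcData

  ∈lcData⇒RotatedLU : ∀ {bs r} → (bs , r) ∈ lcData → RotatedLU m (rotatedLU (bs , r))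
  ∈lcData⇒RotatedLU {bs} {r} p with ∈-cartesianProduct⁻ (allBitLists (m ∸ 1)) (upTo (suc m)) p
  ... | p1 , p2 = record { u = luArrange 1 m bs ; r = r ; uu = luArrange-unique 1 m bs ; uh = luArrange-elems 1 m bs
      (length-∈-allBitLists (m ∸ 1) p1)
                         ; ul = luArrange-leftUnimodal 1 m bs ; r≤ = ≤-pred (∈-upTo⁻ p2) ; eq = refl }

  rotatedLU-injective : ∀ {x y} → x ∈ lcData → y ∈ lcData → rotatedLU x ≡ rotatedLU y → x ≡ y
  rotatedLU-injective {bs , r} {bs' , r'} p q e = cong₂ _,_ ebs er
    where
    d = ∈lcData⇒RotatedLU p
    d' = ∈lcData⇒RotatedLU q
    lb = length-∈-allBitLists (m ∸ 1) (proj₁ (∈-cartesianProduct⁻ (allBitLists (m ∸ 1)) (upTo (suc m)) p))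
    lb' = length-∈-allBitLists (m ∸ 1) (proj₁ (∈-cartesianProduct⁻ (allBitLists (m ∸ 1)) (upTo (suc m)) q))
    u = luArrange 1 m bs
    u° = luArrange 1 m bs'
    module F = SplitFacts (RotatedLU⇒SplitAtMax m (rotatedLU (bs , r)) d)
    module F' = SplitFacts (RotatedLU⇒SplitAtMax m (rotatedLU (bs' , r')) d')
    lu1 : length u ≡ m
    lu1 = length-luArrange 1 m bs lb
    lu2 : length u° ≡ m
    lu2 = length-luArrange 1 m bs' lb'
    la : length (drop r u) ≡ length (drop r' u°)
    la = suc-injective (trans (sym F.posπ) (trans (cong (posOf n) e) F'.posπ))
    er : r ≡ r'
    er = trans (sym (m∸[m∸n]≡n (RotatedLU.r≤ d))) (trans (cong (m ∸_) e') (m∸[m∸n]≡n (RotatedLU.r≤ d')))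
      where
      e' : m ∸ r ≡ m ∸ r'
      e' = trans (sym (trans (length-drop r u) (cong (_∸ r) lu1))) (trans la (trans (length-drop r' u°) (cong (_∸ r') lu2)))
    e2 = ++-injective (drop r u) (n ∷ take r u) (drop r' u°) (n ∷ take r' u°) la e
    eu : u ≡ u°
    eu = trans (sym (take++drop≡id r u)) (trans
          (cong₂ _++_ (trans (∷-injectiveʳ (proj₂ e2)) (cong (λ k → take k u°) (sym er)))
                (trans (proj₁ e2) (cong (λ k → drop k u°) (sym er)))) (take++drop≡id r u°))
    ebs : bs ≡ bs'
    ebs = trans (sym (desBits-luArrange 1 m bs lb)) (trans (cong desBits eu) (desBits-luArrange 1 m bs' lb'))

  lcList-enumerates : Enumerates (InLC n) lcList
  lcList-enumerates =
    map-unique-on rotatedLU lcData (UP.cartesianProduct⁺ (allBitLists-unique (m ∸ 1)) (UP.upTo⁺ (suc m))) rotatedLU-injective ,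
    λ π → mk⇔ (mem⁻ π) (mem⁺ π)
    where
    mem⁻ : ∀ π → π ∈ lcList → InLC n π
    mem⁻ π p with ∈-map⁻ rotatedLU p
    ... | (bs , r) , q , refl = RotatedLU⇒InLC m (RotatedLU.u d) r (RotatedLU.uu d) (RotatedLU.uh d) (RotatedLU.ul d) (RotatedLU.r≤ d)
      where d = ∈lcData⇒RotatedLU q
    mem⁺ : ∀ π → InLC n π → π ∈ lcList
    mem⁺ π lc = subst (_∈ lcList) (sym π≡) (∈-map⁺ rotatedLU (∈-cartesianProduct⁺ bits∈ (∈-upTo⁺ (s≤s r≤))))
      where
      open RotatedLU (InLC⇒RotatedLU m π lc)
      bits∈ : desBits u ∈ allBitLists (m ∸ 1)
      bits∈ = subst (λ k → desBits u ∈ allBitLists k) (trans (length-desBits u) (cong (_∸ 1) (≐interval⇒length uu uh)))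
                (allBitLists-complete (desBits u))
      π≡ : π ≡ rotatedLU (desBits u , r)
      π≡ = trans eq (cong (λ z → drop r z ++ n ∷ take r z) (luArrange-canonical u 1 m uu uh ul))

  InLC⇒SplitAtMax : ∀ {π} → InLC n π → SplitAtMax m π
  InLC⇒SplitAtMax {π} lc = RotatedLU⇒SplitAtMax m π (InLC⇒RotatedLU m π lc)

  φ-Phi : ∀ π → InLC n π → Phi n π (φ m π)
  φ-Phi π lc = Construction.φ-isPhi (InLC⇒SplitAtMax lc)

  Phi-functional : ∀ π w → InLC n π → Phi n π w → w ≡ φ m π
  Phi-functional π w lc = Construction.Phi⇒≡φ (InLC⇒SplitAtMax lc) w

  φ-arc : ∀ π → InLC n π → InA n (φ m π)
  φ-arc π lc = subst (InA n) (sym (Construction.φ≡W ns)) (ArcImage.φ-arc ns)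
    where ns = InLC⇒SplitAtMax lc

  φ-stats : ∀ π → InLC n π → cDes n (φ m π) ≡ cDes n π × posOf n (φ m π) ≡ posOf n π
  φ-stats π lc = trans (cong (cDes n) (Construction.φ≡W ns)) (Statistics.cDesW ns) ,
                 trans (cong (posOf n) (Construction.φ≡W ns)) (trans (Statistics.posW ns) (sym (SplitFacts.posπ ns)))
    where ns = InLC⇒SplitAtMax lc

  φ-injective : ∀ π π′ → InLC n π → InLC n π′ → φ m π ≡ φ m π′ → π ≡ π′
  φ-injective π π′ lc lc′ e = RotatedLU-stats-injective m π π′ (InLC⇒RotatedLU m π lc) (InLC⇒RotatedLU m π′ lc′)
    (trans (sym (proj₂ (φ-stats π lc))) (trans (cong (posOf n) e) (proj₂ (φ-stats π′ lc′))))
    (trans (sym (proj₁ (φ-stats π lc))) (trans (cong (cDes n) e) (proj₁ (φ-stats π′ lc′))))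

  arcList : List (List ℕ)
  arcList = map (φ m) lcList

  arcList-enumerates : Enumerates (InA n) arcList
  arcList-enumerates =
    map-unique-on (φ m) lcList (proj₁ lcList-enumerates) (λ p q → φ-injective _ _ (∈lcList p) (∈lcList q)) ,
    λ w → mk⇔ (mem⁻ w) (mem⁺ w)
    where
    ∈lcList : ∀ {π} → π ∈ lcList → InLC n π
    ∈lcList {π} = to (proj₂ lcList-enumerates π)
    mem⁻ : ∀ w → w ∈ arcList → InA n w
    mem⁻ w p with ∈-map⁻ (φ m) p
    ... | π , q , refl = φ-arc π (∈lcList q)
    mem⁺ : ∀ w → InA n w → w ∈ arcList
    mem⁺ w arc with φ-surjective m w arc
    ... | π , lc , ph = subst (_∈ arcList) (sym (Phi-functional π w lc ph)) (∈-map⁺ (φ m) (from (proj₂ lcList-enumerates π) lc))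

  monomial-arcList : map (monomial n) arcList ≡ map (monomial n) lcList
  monomial-arcList = trans (sym (map-∘ lcList)) (map-cong-local (All.tabulate (λ {π} p →
    let lc = to (proj₂ lcList-enumerates π) p in cong₂ _,_ (proj₁ (φ-stats π lc)) (proj₂ (φ-stats π lc)))))

lemma6p9 : ∀ (n : ℕ) .{{_ : NonZero n}} →
    (∀ π → InLC n π → ∃[ w ] (Phi n π w × (∀ w′ → Phi n π w′ → w′ ≡ w))) ×
    (∀ π w → InLC n π → Phi n π w →
    InA n w × cDes n w ≡ cDes n π × posOf n w ≡ posOf n π) ×
    (∀ π π′ w → InLC n π → InLC n π′ → Phi n π w → Phi n π′ w → π ≡ π′) ×
    (∀ w → InA n w → ∃[ π ] (InLC n π × Phi n π w)) ×
    (∃[ as ] ∃[ ls ] (Enumerates (InA n) as × Enumerates (InLC n) ls ×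
    map (monomial n) as ↭ map (monomial n) ls))
lemma6p9 zero {{nz}} = ⊥-elim-irr (NonZero.nonZero nz)
lemma6p9 (suc m) =
  (λ π lc → φ m π , φ-Phi m π lc , λ w → Phi-functional m π w lc) ,
  (λ π w lc ph → subst (λ v → InA n v × cDes n v ≡ cDes n π × posOf n v ≡ posOf n π)
                       (sym (Phi-functional m π w lc ph)) (φ-arc m π lc , φ-stats m π lc)) ,
  (λ π π′ w lc lc′ ph ph′ → φ-injective m π π′ lc lc′
                              (trans (sym (Phi-functional m π w lc ph)) (Phi-functional m π′ w lc′ ph′))) ,
  φ-surjective m ,
  arcList m , lcList m , arcList-enumerates m , lcList-enumerates m , ↭-reflexive (monomial-arcList m)
  where n = suc m
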